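{- Let $k\ge 1$ be an integer. In the series expansions (as power series in $y,z,q$) of $$\frac{1}{(yq;q)_\infty}\sum_{n\ge 0}\frac{(-1)^n y^n q^{n(n+1)/2} (z;q^k)_n}{(q;q)_n}$$ and of $$(-yq;q)_\infty \sum_{n\ge 0}\frac{(-1)^n y^n q^n (z;q^k)_n}{(q;q)_n},$$ the coefficient of $y^\ell z^m q^n$ is nonnegative for all nonnegative integers $\ell,m,n$.
   Context: The $q$-Pochhammer symbol is $(A;q)_n=\prod_{j=0}^{n-1}(1-Aq^j)$ for $n\in\mathbb{N}\cup\{\infty\}$. -}

module Defs where

open import Data.Nat using (ℕ; zero; suc; _+_; _*_; _∸_; _≡ᵇ_)
open import Data.Bool using (Bool; true; false; _∧_; if_then_else_)
open import Data.Integer using (ℤ; +_; -_) renaming (_+_ to _+ℤ_; _*_ to _*ℤ_; _-_ to _-ℤ_)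

-- Formal power series in three commuting variables y, z, q with integer
-- coefficients: PS f, f a b c = coefficient of y^a z^b q^c.
PS : Set
PS = ℕ → ℕ → ℕ → ℤ

sumTo : ℕ → (ℕ → ℤ) → ℤ
sumTo zero    f = f 0
sumTo (suc n) f = sumTo n f +ℤ f (suc n)

_⊕_ : PS → PS → PS
(f ⊕ g) a b c = f a b c +ℤ g a b c

_⊖_ : PS → PS → PS
(f ⊖ g) a b c = f a b c -ℤ g a b c

_⊛_ : PS → PS → PS
(f ⊛ g) a b c =
  sumTo a λ i → sumTo b λ j → sumTo c λ l →
    f i j l *ℤ g (a ∸ i) (b ∸ j) (c ∸ l)

mono : ℤ → ℕ → ℕ → ℕ → PS
mono s α β γ a b c = if (a ≡ᵇ α) ∧ (b ≡ᵇ β) ∧ (c ≡ᵇ γ) then s else + 0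

one : PS
one = mono (+ 1) 0 0 0

-- geometric series 1/(1 - y^α z^β q^γ) = Σ_{r≥0} y^{rα} z^{rβ} q^{rγ},
-- valid for a nonconstant monomial (only used with γ ≥ 1); the exponent r
-- of a matching term is at most a + b + c.
geom : ℕ → ℕ → ℕ → PS
geom α β γ a b c =
  sumTo (a + b + c) λ r →
    if (a ≡ᵇ r * α) ∧ (b ≡ᵇ r * β) ∧ (c ≡ᵇ r * γ) then + 1 else + 0

prod0 : (ℕ → PS) → ℕ → PS
prod0 F zero    = one
prod0 F (suc n) = prod0 F n ⊛ F n

prod1 : (ℕ → PS) → ℕ → PS
prod1 F zero    = one
prod1 F (suc N) = prod1 F N ⊛ F (suc N)

sumPS : (ℕ → PS) → ℕ → PS
sumPS F zero    = F 0
sumPS F (suc N) = sumPS F N ⊕ F (suc N)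

tri : ℕ → ℕ
tri zero    = 0
tri (suc n) = tri n + suc n

sgn : ℕ → ℤ
sgn zero    = + 1
sgn (suc n) = - sgn n

zPoch : ℕ → ℕ → PS
zPoch k n = prod0 (λ j → one ⊖ mono (+ 1) 0 1 (k * j)) n

qPochInv : ℕ → PS
qPochInv n = prod1 (λ i → geom 0 0 i) n

termA : ℕ → ℕ → PS
termA k n = mono (sgn n) n 0 (tri n) ⊛ (zPoch k n ⊛ qPochInv n)

termB : ℕ → ℕ → PS
termB k n = mono (sgn n) n 0 n ⊛ (zPoch k n ⊛ qPochInv n)

-- truncations of 1/(yq;q)_∞ = Π_{j≥1} 1/(1 - y q^j) and (-yq;q)_∞ = Π_{j≥1}(1 + y q^j)
invYQ : ℕ → PS
invYQ N = prod1 (λ j → geom 1 0 j) N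

negYQ : ℕ → PS
negYQ N = prod1 (λ j → one ⊕ mono (+ 1) 1 0 j) N

seriesA seriesB : ℕ → ℕ → PS
seriesA k N = invYQ N ⊛ sumPS (termA k) N
seriesB k N = negYQ N ⊛ sumPS (termB k) N

-- Factors with j > n
-- of the infinite products are ≡ 1 mod q^{n+1}, and the n'-th summand is
-- divisible by y^{n'}, so truncating both at N = ℓ + n gives the exact
-- coefficient.
coeffA : ℕ → ℕ → ℕ → ℕ → ℤ
coeffA k ℓ m n = seriesA k (ℓ + n) ℓ m n

coeffB : ℕ → ℕ → ℕ → ℕ → ℤ
coeffB k ℓ m n = seriesB k (ℓ + n) ℓ m n

-- Both series are the case j = t = 0 of the family
--   H j t = (Π_{i=1}^{N} F (j + i)) · Σ_{n ≤ N} (-1)^n y^n q^{ex j n} (z q^{K t}; q^K)_n / (q; q)_n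
-- (series A: s = 1, ex j n = n(n+1)/2 + j n, F i = 1/(1 - y q^i);
--  series B: s = 0, ex j n = n + j n,        F i = 1 + y q^i),
-- truncated at N, which leaves the coefficients of y^a z^b q^c with a + c ≤ N unchanged.
-- Comparing H j t with H j (t+1) gives
--   H j t = H j (t+1) + Σ_{r<K} y z q^{K t + j + r + 1} (Π_{i=1}^{s+r} F (j + i)) H (j+s+r) (t+1),
-- whose correction terms are nonnegative multiples of series of lower z-degree, and comparing
-- H j t with H (j+1) t shows that the z-free part does not depend on j.  Moreover H j t only
-- contains monomials with c ≥ (j+1) a + K t b.  So the z-free part equals that of H j′ t for j′
-- large, which vanishes unless a = 0, where only the nonnegative product of the F's contributes;
-- and in z-degree b + 1 a descending induction on t, starting where the support bound forces the
-- coefficient to vanish, only adds nonnegative terms.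

module Submission where

open import Defs

open import Algebra.Bundles using (CommutativeRing)
open import Level using (0ℓ)
import Data.Nat as ℕ
open import Data.Nat using (ℕ; zero; suc; _∸_; _≤_; _<_; _≥_; _≤?_; _≡ᵇ_; z≤n; s≤s)
import Data.Nat.Properties as ℕₚ
open import Data.Nat.Induction using (<-rec)
open import Data.Product using (_×_; _,_)
open import Data.Bool using (true; false; _∧_)
open import Function using (_∘_)
open import Data.Unit using (⊤; tt)
open import Relation.Binary.Bundles using (Setoid)
open import Relation.Nullary using (¬_; Dec; yes; no; contradiction)
open import Relation.Nullary.Decidable using (_×-dec_)
open import Relation.Binary.PropositionalEquality as ≡ using (_≡_; _≢_)
import Relation.Binary.Reasoning.Setoid as SetoidReasoning

module FiniteSums {c ℓ} (R : CommutativeRing c ℓ) where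
  open CommutativeRing R
  open SetoidReasoning setoid

  sum≤ : ℕ → (ℕ → Carrier) → Carrier
  sum≤ zero    f = f 0
  sum≤ (suc n) f = sum≤ n f + f (suc n)

  sum≤-cong : ∀ n {f g : ℕ → Carrier} → (∀ i → i ≤ n → f i ≈ g i) → sum≤ n f ≈ sum≤ n g
  sum≤-cong zero    f≈g = f≈g 0 z≤n
  sum≤-cong (suc n) f≈g =
    +-cong (sum≤-cong n (λ i i≤n → f≈g i (ℕₚ.m≤n⇒m≤1+n i≤n))) (f≈g (suc n) ℕₚ.≤-refl)

  sum≤-zero : ∀ n → sum≤ n (λ _ → 0#) ≈ 0#
  sum≤-zero zero    = refl
  sum≤-zero (suc n) = trans (+-congʳ (sum≤-zero n)) (+-identityˡ 0#)

  sum≤-+ : ∀ n (f g : ℕ → Carrier) → sum≤ n (λ i → f i + g i) ≈ sum≤ n f + sum≤ n g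
  sum≤-+ zero    f g = refl
  sum≤-+ (suc n) f g = begin
    sum≤ n (λ i → f i + g i) + (f (suc n) + g (suc n))
      ≈⟨ +-congʳ (sum≤-+ n f g) ⟩
    (sum≤ n f + sum≤ n g) + (f (suc n) + g (suc n))
      ≈⟨ +-assoc _ _ _ ⟩
    sum≤ n f + (sum≤ n g + (f (suc n) + g (suc n)))
      ≈⟨ +-congˡ (trans (sym (+-assoc _ _ _)) (trans (+-congʳ (+-comm _ _)) (+-assoc _ _ _))) ⟩
    sum≤ n f + (f (suc n) + (sum≤ n g + g (suc n)))
      ≈⟨ sym (+-assoc _ _ _) ⟩
    (sum≤ n f + f (suc n)) + (sum≤ n g + g (suc n)) ∎

  *-distribˡ-sum≤ : ∀ n x (f : ℕ → Carrier) → x * sum≤ n f ≈ sum≤ n (λ i → x * f i)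
  *-distribˡ-sum≤ zero    x f = refl
  *-distribˡ-sum≤ (suc n) x f = trans (distribˡ x _ _) (+-congʳ (*-distribˡ-sum≤ n x f))

  *-distribʳ-sum≤ : ∀ n x (f : ℕ → Carrier) → sum≤ n f * x ≈ sum≤ n (λ i → f i * x)
  *-distribʳ-sum≤ zero    x f = refl
  *-distribʳ-sum≤ (suc n) x f = trans (distribʳ x _ _) (+-congʳ (*-distribʳ-sum≤ n x f))

  sum≤-unfoldˡ : ∀ n (f : ℕ → Carrier) → sum≤ (suc n) f ≈ f 0 + sum≤ n (λ i → f (suc i))
  sum≤-unfoldˡ zero    f = refl
  sum≤-unfoldˡ (suc n) f = trans (+-congʳ (sum≤-unfoldˡ n f)) (+-assoc _ _ _)

  sum≤-reverse : ∀ n (f : ℕ → Carrier) → sum≤ n (λ i → f (n ∸ i)) ≈ sum≤ n f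
  sum≤-reverse zero    f = refl
  sum≤-reverse (suc n) f = begin
    sum≤ (suc n) (λ i → f (suc n ∸ i)) ≈⟨ sum≤-unfoldˡ n _ ⟩
    f (suc n) + sum≤ n (λ i → f (n ∸ i)) ≈⟨ +-congˡ (sum≤-reverse n f) ⟩
    f (suc n) + sum≤ n f                 ≈⟨ +-comm _ _ ⟩
    sum≤ n f + f (suc n)                 ∎

  sum≤-triangle : ∀ n (F : ℕ → ℕ → Carrier) →
    sum≤ n (λ i → sum≤ i (F i)) ≈ sum≤ n (λ j → sum≤ (n ∸ j) (λ l → F (j ℕ.+ l) j))
  sum≤-triangle zero    F = refl
  sum≤-triangle (suc n) F = begin
    sum≤ n (λ i → sum≤ i (F i)) + (sum≤ n (F (suc n)) + F (suc n) (suc n))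
      ≈⟨ trans (+-congʳ (sum≤-triangle n F)) (sym (+-assoc _ _ _)) ⟩
    (sum≤ n (λ j → sum≤ (n ∸ j) (λ l → F (j ℕ.+ l) j)) + sum≤ n (F (suc n))) + F (suc n) (suc n)
      ≈⟨ +-congʳ (sym (sum≤-+ n _ _)) ⟩
    sum≤ n (λ j → sum≤ (n ∸ j) (λ l → F (j ℕ.+ l) j) + F (suc n) j) + F (suc n) (suc n)
      ≈⟨ +-cong (sum≤-cong n extend-row) (sym (last-row (suc n))) ⟩
    sum≤ n (λ j → sum≤ (suc n ∸ j) (λ l → F (j ℕ.+ l) j))
      + sum≤ (suc n ∸ suc n) (λ l → F (suc n ℕ.+ l) (suc n)) ∎
    where
    last-row : ∀ m → sum≤ (m ∸ m) (λ l → F (m ℕ.+ l) m) ≈ F m m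
    last-row m rewrite ℕₚ.n∸n≡0 m | ℕₚ.+-identityʳ m = refl
    extend-row : ∀ j → j ≤ n → sum≤ (n ∸ j) (λ l → F (j ℕ.+ l) j) + F (suc n) j
                              ≈ sum≤ (suc n ∸ j) (λ l → F (j ℕ.+ l) j)
    extend-row j j≤n rewrite ℕₚ.+-∸-assoc 1 j≤n =
      +-congˡ (reflexive (≡.cong (λ x → F x j) (≡.sym j+suc[n∸j]≡suc-n)))
      where
      j+suc[n∸j]≡suc-n : j ℕ.+ suc (n ∸ j) ≡ suc n
      j+suc[n∸j]≡suc-n =
        ≡.trans (ℕₚ.+-suc j (n ∸ j)) (≡.cong suc (≡.trans (≡.sym (ℕₚ.+-∸-assoc j j≤n)) (ℕₚ.m+n∸m≡n j n)))

module PowerSeries {c ℓ} (R : CommutativeRing c ℓ) where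
  open CommutativeRing R
  open FiniteSums R
  open SetoidReasoning setoid

  Series : Set c
  Series = ℕ → Carrier

  infix  4 _≈ₛ_
  infixl 6 _+ₛ_
  infixl 7 _*ₛ_

  _≈ₛ_ : Series → Series → Set ℓ
  f ≈ₛ g = ∀ n → f n ≈ g n

  _+ₛ_ : Series → Series → Series
  (f +ₛ g) n = f n + g n

  -ₛ_ : Series → Series
  (-ₛ f) n = - f n

  0ₛ : Series
  0ₛ _ = 0#

  1ₛ : Series
  1ₛ zero    = 1#
  1ₛ (suc _) = 0#

  _*ₛ_ : Series → Series → Series
  (f *ₛ g) n = sum≤ n (λ i → f i * g (n ∸ i))

  *ₛ-comm : ∀ f g → f *ₛ g ≈ₛ g *ₛ f
  *ₛ-comm f g n = begin
    sum≤ n (λ i → f i * g (n ∸ i))             ≈⟨ sym (sum≤-reverse n _) ⟩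
    sum≤ n (λ i → f (n ∸ i) * g (n ∸ (n ∸ i))) ≈⟨ sum≤-cong n (λ i i≤n →
      trans (*-comm _ _) (*-congʳ (reflexive (≡.cong g (ℕₚ.m∸[m∸n]≡n i≤n))))) ⟩
    sum≤ n (λ i → g i * f (n ∸ i))             ∎

  *ₛ-cong : ∀ {f f′ g g′} → f ≈ₛ f′ → g ≈ₛ g′ → f *ₛ g ≈ₛ f′ *ₛ g′
  *ₛ-cong f≈f′ g≈g′ n = sum≤-cong n (λ i _ → *-cong (f≈f′ i) (g≈g′ (n ∸ i)))

  *ₛ-assoc : ∀ f g h → (f *ₛ g) *ₛ h ≈ₛ f *ₛ (g *ₛ h)
  *ₛ-assoc f g h n = begin
    sum≤ n (λ i → sum≤ i (λ j → f j * g (i ∸ j)) * h (n ∸ i))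
      ≈⟨ sum≤-cong n (λ i _ → *-distribʳ-sum≤ i _ _) ⟩
    sum≤ n (λ i → sum≤ i (λ j → f j * g (i ∸ j) * h (n ∸ i)))
      ≈⟨ sum≤-triangle n _ ⟩
    sum≤ n (λ j → sum≤ (n ∸ j) (λ l → f j * g ((j ℕ.+ l) ∸ j) * h (n ∸ (j ℕ.+ l))))
      ≈⟨ sum≤-cong n (λ j _ → sum≤-cong (n ∸ j) (λ l _ →
           trans (*-assoc _ _ _) (*-congˡ (*-cong (reflexive (≡.cong g (ℕₚ.m+n∸m≡n j l)))
                                                  (reflexive (≡.cong h (≡.sym (ℕₚ.∸-+-assoc n j l)))))))) ⟩
    sum≤ n (λ j → sum≤ (n ∸ j) (λ l → f j * (g l * h (n ∸ j ∸ l))))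
      ≈⟨ sum≤-cong n (λ j _ → sym (*-distribˡ-sum≤ (n ∸ j) _ _)) ⟩
    sum≤ n (λ j → f j * sum≤ (n ∸ j) (λ l → g l * h (n ∸ j ∸ l))) ∎

  *ₛ-identityˡ : ∀ f → 1ₛ *ₛ f ≈ₛ f
  *ₛ-identityˡ f zero    = *-identityˡ (f 0)
  *ₛ-identityˡ f (suc n) = begin
    sum≤ (suc n) (λ i → 1ₛ i * f (suc n ∸ i))      ≈⟨ sum≤-unfoldˡ n _ ⟩
    1# * f (suc n) + sum≤ n (λ i → 0# * f (n ∸ i)) ≈⟨ +-cong (*-identityˡ _) (sum≤-cong n (λ i _ → zeroˡ _)) ⟩
    f (suc n) + sum≤ n (λ _ → 0#)                  ≈⟨ trans (+-congˡ (sum≤-zero n)) (+-identityʳ _) ⟩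
    f (suc n)                                      ∎

  *ₛ-distribʳ : ∀ f g h → (g +ₛ h) *ₛ f ≈ₛ g *ₛ f +ₛ h *ₛ f
  *ₛ-distribʳ f g h n = trans (sum≤-cong n (λ i _ → distribʳ _ _ _)) (sum≤-+ n _ _)

  commutativeRing : CommutativeRing c ℓ
  commutativeRing = record
    { Carrier = Series
    ; _≈_ = _≈ₛ_
    ; _+_ = _+ₛ_
    ; _*_ = _*ₛ_
    ; -_ = -ₛ_
    ; 0# = 0ₛ
    ; 1# = 1ₛ
    ; isCommutativeRing = record
      { isRing = record
        { +-isAbelianGroup = record
          { isGroup = record
            { isMonoid = record
              { isSemigroup = record
                { isMagma = record
                  { isEquivalence = record
                    { refl = λ n → refl ; sym = λ p n → sym (p n) ; trans = λ p q n → trans (p n) (q n) }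
                  ; ∙-cong = λ p q n → +-cong (p n) (q n) }
                ; assoc = λ f g h n → +-assoc _ _ _ }
              ; identity = (λ f n → +-identityˡ _) , (λ f n → +-identityʳ _) }
            ; inverse = (λ f n → -‿inverseˡ _) , (λ f n → -‿inverseʳ _)
            ; ⁻¹-cong = λ p n → -‿cong (p n) }
          ; comm = λ f g n → +-comm _ _ }
        ; *-cong = *ₛ-cong
        ; *-assoc = *ₛ-assoc
        ; *-identity = *ₛ-identityˡ , λ f n → trans (*ₛ-comm f 1ₛ n) (*ₛ-identityˡ f n)
        ; distrib = (λ f g h n → trans (*ₛ-comm f _ n) (trans (*ₛ-distribʳ f g h n)
                                   (+-cong (*ₛ-comm g f n) (*ₛ-comm h f n))))
                  , *ₛ-distribʳ }
      ; *-comm = *ₛ-comm }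
    }

  open FiniteSums commutativeRing using () renaming (sum≤ to sum≤ₛ)

  sum≤ₛ-apply : ∀ n (F : ℕ → Series) m → sum≤ₛ n F m ≡ sum≤ n (λ i → F i m)
  sum≤ₛ-apply zero    F m = ≡.refl
  sum≤ₛ-apply (suc n) F m = ≡.cong (_+ F (suc n) m) (sum≤ₛ-apply n F m)

-- ℕ and ℤ arithmetic only come into scope here: the modules above use the ring's _+_, _*_ and -_.
open import Data.Nat using (_+_; _*_; _<?_)
open import Data.Nat.Tactic.RingSolver using (solve-∀; solve)
open import Data.Integer.Tactic.RingSolver using () renaming (solve-∀ to ℤ-solve-∀)
open import Data.List using (_∷_; [])
open import Data.Integer as ℤ using (ℤ; +_; -_)
  renaming (_+_ to _+ℤ_; _*_ to _*ℤ_; _-_ to _-ℤ_; _≤_ to _≤ℤ_)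
import Data.Integer.Properties as ℤₚ
open import Algebra.Properties.AbelianGroup ℤₚ.+-0-abelianGroup using (∙-cancelʳ)

sumTo-cong : ∀ n {f g : ℕ → ℤ} → (∀ i → i ≤ n → f i ≡ g i) → sumTo n f ≡ sumTo n g
sumTo-cong zero    f≡g = f≡g 0 z≤n
sumTo-cong (suc n) f≡g =
  ≡.cong₂ _+ℤ_ (sumTo-cong n (λ i i≤n → f≡g i (ℕₚ.m≤n⇒m≤1+n i≤n))) (f≡g (suc n) ℕₚ.≤-refl)

sumTo-zero : ∀ n {f : ℕ → ℤ} → (∀ i → i ≤ n → f i ≡ + 0) → sumTo n f ≡ + 0
sumTo-zero zero    f≡0 = f≡0 0 z≤n
sumTo-zero (suc n) f≡0 =
  ≡.cong₂ _+ℤ_ (sumTo-zero n (λ i i≤n → f≡0 i (ℕₚ.m≤n⇒m≤1+n i≤n))) (f≡0 (suc n) ℕₚ.≤-refl)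

sumTo-single : ∀ n {α} {f : ℕ → ℤ} → α ≤ n → (∀ i → i ≢ α → f i ≡ + 0) → sumTo n f ≡ f α
sumTo-single zero    z≤n f≡0 = ≡.refl
sumTo-single (suc n) {α} {f} α≤1+n f≡0 with α ℕₚ.≟ suc n
... | yes ≡.refl = ≡.trans (≡.cong (_+ℤ f (suc n)) (sumTo-zero n (λ i i≤n → f≡0 i (ℕₚ.<⇒≢ (s≤s i≤n)))))
                           (ℤₚ.+-identityˡ _)
... | no α≢1+n = ≡.trans (≡.cong₂ _+ℤ_ (sumTo-single n (ℕₚ.≤-pred (ℕₚ.≤∧≢⇒< α≤1+n α≢1+n)) f≡0)
                                      (f≡0 (suc n) (α≢1+n ∘ ≡.sym)))
                         (ℤₚ.+-identityʳ _)

sumTo-extend : ∀ {n} m {f : ℕ → ℤ} → n ≤ m → (∀ i → n < i → f i ≡ + 0) → sumTo m f ≡ sumTo n f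
sumTo-extend zero    z≤n _ = ≡.refl
sumTo-extend {n} (suc m) {f} n≤1+m f≡0 with n ≤? m
... | yes n≤m = ≡.trans (≡.cong₂ _+ℤ_ (sumTo-extend m n≤m f≡0) (f≡0 (suc m) (s≤s n≤m)))
                        (ℤₚ.+-identityʳ _)
... | no n≰m rewrite ℕₚ.≤-antisym n≤1+m (ℕₚ.≰⇒> n≰m) = ≡.refl

sumTo-unfoldˡ : ∀ n (f : ℕ → ℤ) → sumTo (suc n) f ≡ f 0 +ℤ sumTo n (λ i → f (suc i))
sumTo-unfoldˡ zero    f = ≡.refl
sumTo-unfoldˡ (suc n) f = ≡.trans (≡.cong (_+ℤ f (suc (suc n))) (sumTo-unfoldˡ n f)) (ℤₚ.+-assoc (f 0) _ _)

sumTo-nonneg : ∀ n {f : ℕ → ℤ} → (∀ i → i ≤ n → + 0 ≤ℤ f i) → + 0 ≤ℤ sumTo n f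
sumTo-nonneg zero    f≥0 = f≥0 0 z≤n
sumTo-nonneg (suc n) f≥0 =
  ℤₚ.+-mono-≤ (sumTo-nonneg n (λ i i≤n → f≥0 i (ℕₚ.m≤n⇒m≤1+n i≤n))) (f≥0 (suc n) ℕₚ.≤-refl)

private
  module Series₁ = PowerSeries ℤₚ.+-*-commutativeRing
  module Series₂ = PowerSeries Series₁.commutativeRing
  module Series₃ = PowerSeries Series₂.commutativeRing

infix 4 _≐_
record _≐_ (f g : PS) : Set where
  constructor coeffwise
  field coeff : ∀ a b c → f a b c ≡ g a b c
open _≐_ public

sum≤≡sumTo : ∀ n f → FiniteSums.sum≤ ℤₚ.+-*-commutativeRing n f ≡ sumTo n f
sum≤≡sumTo zero    f = ≡.refl
sum≤≡sumTo (suc n) f = ≡.cong (_+ℤ f (suc n)) (sum≤≡sumTo n f)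

-- PS is ℤ[[q]][[z]][[y]], and _⊛_ is its iterated Cauchy product, so PS inherits the ring laws.
⊛-≈-*ₛ : ∀ f g → Series₃._≈ₛ_ (f ⊛ g) (Series₃._*ₛ_ f g)
⊛-≈-*ₛ f g a b c = ≡.sym (begin
  Series₃._*ₛ_ f g a b c
    ≡⟨ ≡.cong (λ h → h c) (Series₂.sum≤ₛ-apply a _ b) ⟩
  _ ≡⟨ Series₁.sum≤ₛ-apply a _ c ⟩
  _ ≡⟨ sum≤≡sumTo a _ ⟩
  _ ≡⟨ sumTo-cong a (λ i _ → ≡.trans (Series₁.sum≤ₛ-apply b _ c) (≡.trans (sum≤≡sumTo b _)
         (sumTo-cong b (λ j _ → sum≤≡sumTo c _)))) ⟩
  (f ⊛ g) a b c ∎)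
  where open ≡.≡-Reasoning

_⊝ : PS → PS
(f ⊝) a b c = - f a b c

zero-PS : PS
zero-PS _ _ _ = + 0

one≈1ₛ : Series₃._≈ₛ_ one Series₃.1ₛ
one≈1ₛ zero    zero    zero    = ≡.refl
one≈1ₛ zero    zero    (suc c) = ≡.refl
one≈1ₛ zero    (suc b) c       = ≡.refl
one≈1ₛ (suc a) b       c       = ≡.refl

PS-commutativeRing : CommutativeRing 0ℓ 0ℓ
PS-commutativeRing = record
  { Carrier = PS
  ; _≈_ = _≐_
  ; _+_ = _⊕_
  ; _*_ = _⊛_
  ; -_ = _⊝
  ; 0# = zero-PS
  ; 1# = one
  ; isCommutativeRing = record
    { isRing = record
      { +-isAbelianGroup = record
        { isGroup = record
          { isMonoid = record
            { isSemigroup = record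
              { isMagma = record
                { isEquivalence = record
                  { refl  = coeffwise λ _ _ _ → ≡.refl
                  ; sym   = λ p → coeffwise λ a b c → ≡.sym (coeff p a b c)
                  ; trans = λ p q → coeffwise λ a b c → ≡.trans (coeff p a b c) (coeff q a b c) }
                ; ∙-cong = λ p q → coeffwise λ a b c → ≡.cong₂ _+ℤ_ (coeff p a b c) (coeff q a b c) }
              ; assoc = λ f g h → coeffwise λ a b c → ℤₚ.+-assoc (f a b c) _ _ }
            ; identity = (λ f → coeffwise λ a b c → ℤₚ.+-identityˡ _)
                       , (λ f → coeffwise λ a b c → ℤₚ.+-identityʳ _) }
          ; inverse = (λ f → coeffwise λ a b c → ℤₚ.+-inverseˡ (f a b c))
                    , (λ f → coeffwise λ a b c → ℤₚ.+-inverseʳ (f a b c))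
          ; ⁻¹-cong = λ p → coeffwise λ a b c → ≡.cong -_ (coeff p a b c) }
        ; comm = λ f g → coeffwise λ a b c → ℤₚ.+-comm (f a b c) _ }
      ; *-cong = λ {f} {f′} {g} {g′} p q → via-*ₛ {f} {g} {f′} {g′} (R₃.*-cong (coeff p) (coeff q))
      ; *-assoc = λ f g h → via-*ₛ {f ⊛ g} {h} {f} {g ⊛ h} (R₃.trans (R₃.*-cong (⊛-≈-*ₛ f g) (R₃.refl {h}))
                                   (R₃.trans (R₃.*-assoc f g h) (R₃.*-cong (R₃.refl {f}) (R₃.sym (⊛-≈-*ₛ g h)))))
      ; *-identity = ⊛-identityˡ , λ f → ≐-trans (via-*ₛ {f} {one} {one} {f} (R₃.*-comm f one)) (⊛-identityˡ f)
      ; distrib = (λ f g h → ≐-trans (≐-via (⊛-≈-*ₛ f (g ⊕ h)))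
                                     (⊕-from-*ₛ {f = f} {g} {f} {h} (R₃.distribˡ f g h)))
                , (λ f g h → ≐-trans (≐-via (⊛-≈-*ₛ (g ⊕ h) f))
                                     (⊕-from-*ₛ {f = g} {f} {h} {f} (R₃.distribʳ f g h))) }
    ; *-comm = λ f g → via-*ₛ {f} {g} {g} {f} (R₃.*-comm f g) }
  }
  where
  module R₃ = CommutativeRing Series₃.commutativeRing
  ≐-via : ∀ {f g} → Series₃._≈ₛ_ f g → f ≐ g
  ≐-via p = coeffwise p
  ≐-trans : ∀ {f g h} → f ≐ g → g ≐ h → f ≐ h
  ≐-trans p q = coeffwise λ a b c → ≡.trans (coeff p a b c) (coeff q a b c)
  via-*ₛ : ∀ {f g f′ g′} → Series₃._≈ₛ_ (Series₃._*ₛ_ f g) (Series₃._*ₛ_ f′ g′) →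
           f ⊛ g ≐ f′ ⊛ g′
  via-*ₛ {f} {g} {f′} {g′} p = coeffwise λ a b c →
    ≡.trans (⊛-≈-*ₛ f g a b c) (≡.trans (p a b c) (≡.sym (⊛-≈-*ₛ f′ g′ a b c)))
  ⊕-from-*ₛ : ∀ {x f g f′ g′} → Series₃._≈ₛ_ x (Series₃._*ₛ_ f g ⊕ Series₃._*ₛ_ f′ g′) →
              x ≐ (f ⊛ g) ⊕ (f′ ⊛ g′)
  ⊕-from-*ₛ {x} {f} {g} {f′} {g′} p = coeffwise λ a b c →
    ≡.trans (p a b c) (≡.cong₂ _+ℤ_ (≡.sym (⊛-≈-*ₛ f g a b c)) (≡.sym (⊛-≈-*ₛ f′ g′ a b c)))
  ⊛-identityˡ : ∀ f → one ⊛ f ≐ f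
  ⊛-identityˡ f = coeffwise
    (R₃.trans (⊛-≈-*ₛ one f) (R₃.trans (R₃.*-cong one≈1ₛ (R₃.refl {f})) (Series₃.*ₛ-identityˡ f)))

private module PS = CommutativeRing PS-commutativeRing

≐-setoid : Setoid 0ℓ 0ℓ
≐-setoid = PS.setoid

≐-refl : ∀ {f} → f ≐ f
≐-refl = PS.refl

≐-sym : ∀ {f g} → f ≐ g → g ≐ f
≐-sym = PS.sym

≐-trans : ∀ {f g h} → f ≐ g → g ≐ h → f ≐ h
≐-trans = PS.trans

⊕-cong : ∀ {f f′ g g′} → f ≐ f′ → g ≐ g′ → f ⊕ g ≐ f′ ⊕ g′
⊕-cong = PS.+-cong

⊝-cong : ∀ {f f′} → f ≐ f′ → f ⊝ ≐ f′ ⊝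
⊝-cong = PS.-‿cong

⊛-cong : ∀ {f f′ g g′} → f ≐ f′ → g ≐ g′ → f ⊛ g ≐ f′ ⊛ g′
⊛-cong = PS.*-cong

-- The fixed operand is explicit: PS is a function type, so unification looks through _⊕_ and _⊛_
-- and cannot recover it from the goal.
⊕-congˡ : ∀ f {g g′} → g ≐ g′ → f ⊕ g ≐ f ⊕ g′
⊕-congˡ f = ⊕-cong (≐-refl {f})

⊛-congˡ : ∀ f {g g′} → g ≐ g′ → f ⊛ g ≐ f ⊛ g′
⊛-congˡ f = ⊛-cong (≐-refl {f})

⊛-congʳ : ∀ g {f f′} → f ≐ f′ → f ⊛ g ≐ f′ ⊛ g
⊛-congʳ g f≐f′ = ⊛-cong f≐f′ (≐-refl {g})

≡⇒≐ : ∀ {f g} → f ≡ g → f ≐ g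
≡⇒≐ ≡.refl = ≐-refl

⊖-cong : ∀ {f f′ g g′} → f ≐ f′ → g ≐ g′ → f ⊖ g ≐ f′ ⊖ g′
⊖-cong f≐f′ g≐g′ = coeffwise λ a b c → ≡.cong₂ _-ℤ_ (coeff f≐f′ a b c) (coeff g≐g′ a b c)

⊖-congˡ : ∀ f {g g′} → g ≐ g′ → f ⊖ g ≐ f ⊖ g′
⊖-congˡ f = ⊖-cong (≐-refl {f})

⊖-congʳ : ∀ g {f f′} → f ≐ f′ → f ⊖ g ≐ f′ ⊖ g
⊖-congʳ g f≐f′ = ⊖-cong f≐f′ (≐-refl {g})

⊛-assoc : ∀ f g h → (f ⊛ g) ⊛ h ≐ f ⊛ (g ⊛ h)
⊛-assoc = PS.*-assoc

⊛-comm : ∀ f g → f ⊛ g ≐ g ⊛ f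
⊛-comm = PS.*-comm

⊛-identityˡ : ∀ f → one ⊛ f ≐ f
⊛-identityˡ = PS.*-identityˡ

⊛-identityʳ : ∀ f → f ⊛ one ≐ f
⊛-identityʳ = PS.*-identityʳ

⊖-self : ∀ f → f ⊖ f ≐ zero-PS
⊖-self = PS.-‿inverseʳ

⊕-identityʳ : ∀ f → f ⊕ zero-PS ≐ f
⊕-identityʳ = PS.+-identityʳ

⊖-identityʳ : ∀ f → f ⊖ zero-PS ≐ f
⊖-identityʳ f = coeffwise λ a b c → ℤₚ.+-identityʳ (f a b c)

⊛-zeroʳ : ∀ f → f ⊛ zero-PS ≐ zero-PS
⊛-zeroʳ = PS.zeroʳ

≡ᵇ-refl : ∀ n → (n ≡ᵇ n) ≡ true
≡ᵇ-refl zero    = ≡.refl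
≡ᵇ-refl (suc n) = ≡ᵇ-refl n

≡ᵇ-∸ : ∀ {a} α x → α ≤ a → (a ∸ α ≡ᵇ x) ≡ (a ≡ᵇ α + x)
≡ᵇ-∸ {a} α x α≤a = ≡.trans (≡ᵇ-+ α) (≡.cong (_≡ᵇ α + x) (ℕₚ.m+[n∸m]≡n α≤a))
  where
  ≡ᵇ-+ : ∀ α {y} → (y ≡ᵇ x) ≡ (α + y ≡ᵇ α + x)
  ≡ᵇ-+ zero    = ≡.refl
  ≡ᵇ-+ (suc α) = ≡ᵇ-+ α

mono-on : ∀ s α β γ → mono s α β γ α β γ ≡ s
mono-on s α β γ rewrite ≡ᵇ-refl α | ≡ᵇ-refl β | ≡ᵇ-refl γ = ≡.refl

mono-off : ∀ s α β γ a b c → ¬ (a ≡ α × b ≡ β × c ≡ γ) → mono s α β γ a b c ≡ + 0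
mono-off s α β γ a b c ≢
  with a ≡ᵇ α | ℕₚ.≡ᵇ⇒≡ a α | b ≡ᵇ β | ℕₚ.≡ᵇ⇒≡ b β | c ≡ᵇ γ | ℕₚ.≡ᵇ⇒≡ c γ
... | false | _ | _     | _ | _     | _ = ≡.refl
... | true  | _ | false | _ | _     | _ = ≡.refl
... | true  | _ | true  | _ | false | _ = ≡.refl
... | true  | p | true  | q | true  | r = contradiction (p _ , q _ , r _) ≢

mono-∸ : ∀ s α β γ {a b c} α₀ β₀ γ₀ → α₀ ≤ a → β₀ ≤ b → γ₀ ≤ c →
  mono s α β γ (a ∸ α₀) (b ∸ β₀) (c ∸ γ₀) ≡ mono s (α₀ + α) (β₀ + β) (γ₀ + γ) a b c
mono-∸ s α β γ α₀ β₀ γ₀ α₀≤a β₀≤b γ₀≤c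
  rewrite ≡ᵇ-∸ α₀ α α₀≤a | ≡ᵇ-∸ β₀ β β₀≤b | ≡ᵇ-∸ γ₀ γ γ₀≤c = ≡.refl

*ℤ-mono : ∀ s t α β γ a b c → s *ℤ mono t α β γ a b c ≡ mono (s *ℤ t) α β γ a b c
*ℤ-mono s t α β γ a b c with (a ≡ᵇ α) ∧ (b ≡ᵇ β) ∧ (c ≡ᵇ γ)
... | true  = ≡.refl
... | false = ℤₚ.*-zeroʳ s

Divides³ : (α β γ a b c : ℕ) → Set
Divides³ α β γ a b c = α ≤ a × β ≤ b × γ ≤ c

divides³? : ∀ α β γ a b c → Dec (Divides³ α β γ a b c)
divides³? α β γ a b c = (α ≤? a) ×-dec (β ≤? b) ×-dec (γ ≤? c)

mono-off-∤ : ∀ s α β γ a b c → ¬ Divides³ α β γ a b c → mono s α β γ a b c ≡ + 0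
mono-off-∤ s α β γ a b c ∤ =
  mono-off s α β γ a b c λ { (≡.refl , ≡.refl , ≡.refl) → ∤ (ℕₚ.≤-refl , ℕₚ.≤-refl , ℕₚ.≤-refl) }

mono-⊛-coeff : ∀ s α β γ f a b c → Divides³ α β γ a b c →
  (mono s α β γ ⊛ f) a b c ≡ s *ℤ f (a ∸ α) (b ∸ β) (c ∸ γ)
mono-⊛-coeff s α β γ f a b c (α≤a , β≤b , γ≤c) =
  ≡.trans (sumTo-single a α≤a (λ i i≢α → sumTo-zero b (λ j _ → sumTo-zero c (λ l _ →
            ≡.cong (_*ℤ _) (mono-off s α β γ i j l (λ (e , _) → i≢α e))))))
  (≡.trans (sumTo-single b β≤b (λ j j≢β → sumTo-zero c (λ l _ →
            ≡.cong (_*ℤ _) (mono-off s α β γ α j l (λ (_ , e , _) → j≢β e)))))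
  (≡.trans (sumTo-single c γ≤c (λ l l≢γ → ≡.cong (_*ℤ _) (mono-off s α β γ α β l (λ (_ , _ , e) → l≢γ e))))
           (≡.cong (_*ℤ _) (mono-on s α β γ))))

mono-⊛-coeff-∤ : ∀ s α β γ f a b c → ¬ Divides³ α β γ a b c → (mono s α β γ ⊛ f) a b c ≡ + 0
mono-⊛-coeff-∤ s α β γ f a b c ∤ =
  sumTo-zero a (λ i i≤a → sumTo-zero b (λ j j≤b → sumTo-zero c (λ l l≤c →
    ≡.cong (_*ℤ _) (mono-off s α β γ i j l (λ { (≡.refl , ≡.refl , ≡.refl) → ∤ (i≤a , j≤b , l≤c) })))))

mono-⊛-mono : ∀ s t α β γ α′ β′ γ′ →
  mono s α β γ ⊛ mono t α′ β′ γ′ ≐ mono (s *ℤ t) (α + α′) (β + β′) (γ + γ′)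
mono-⊛-mono s t α β γ α′ β′ γ′ = coeffwise product
  where
  product : ∀ a b c →
    (mono s α β γ ⊛ mono t α′ β′ γ′) a b c ≡ mono (s *ℤ t) (α + α′) (β + β′) (γ + γ′) a b c
  product a b c with divides³? α β γ a b c
  ... | yes d@(α≤a , β≤b , γ≤c) =
    ≡.trans (mono-⊛-coeff s α β γ (mono t α′ β′ γ′) a b c d)
    (≡.trans (≡.cong (s *ℤ_) (mono-∸ t α′ β′ γ′ α β γ α≤a β≤b γ≤c)) (*ℤ-mono s t _ _ _ a b c))
  ... | no ∤ =
    ≡.trans (mono-⊛-coeff-∤ s α β γ (mono t α′ β′ γ′) a b c ∤)
    (≡.sym (mono-off-∤ _ _ _ _ a b c λ (p , q , r) →
       ∤ (ℕₚ.m+n≤o⇒m≤o α p , ℕₚ.m+n≤o⇒m≤o β q , ℕₚ.m+n≤o⇒m≤o γ r)))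

mono-cong : ∀ {s s′ α α′ β β′ γ γ′} → s ≡ s′ → α ≡ α′ → β ≡ β′ → γ ≡ γ′ →
  mono s α β γ ≐ mono s′ α′ β′ γ′
mono-cong ≡.refl ≡.refl ≡.refl ≡.refl = ≐-refl

mono-⊝ : ∀ s α β γ → mono (- s) α β γ ≐ mono s α β γ ⊝
mono-⊝ s α β γ = coeffwise negate
  where
  negate : ∀ a b c → mono (- s) α β γ a b c ≡ - mono s α β γ a b c
  negate a b c with (a ≡ᵇ α) ∧ (b ≡ᵇ β) ∧ (c ≡ᵇ γ)
  ... | true  = ≡.refl
  ... | false = ≡.refl

mono-nonneg : ∀ n α β γ a b c → + 0 ≤ℤ mono (+ n) α β γ a b c
mono-nonneg n α β γ a b c with (a ≡ᵇ α) ∧ (b ≡ᵇ β) ∧ (c ≡ᵇ γ)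
... | true  = ℤ.+≤+ z≤n
... | false = ℤ.+≤+ z≤n

module PS-Solver where
  open import Algebra.Solver.Ring.AlmostCommutativeRing
    using (fromCommutativeRing; _-Raw-AlmostCommutative⟶_)
  open import Data.Maybe using (Maybe; just; nothing)

  constant : ℤ → PS
  constant s = mono s 0 0 0

  constant-homomorphism :
    CommutativeRing.rawRing ℤₚ.+-*-commutativeRing -Raw-AlmostCommutative⟶ fromCommutativeRing PS-commutativeRing
  constant-homomorphism = record
    { ⟦_⟧    = constant
    ; +-homo = λ s t → coeffwise λ a b c → +-homo s t (a ≡ᵇ 0) (b ≡ᵇ 0) (c ≡ᵇ 0)
    ; *-homo = λ s t → ≐-sym (mono-⊛-mono s t 0 0 0 0 0 0)
    ; -‿homo = λ s → coeffwise λ a b c → -‿homo s (a ≡ᵇ 0) (b ≡ᵇ 0) (c ≡ᵇ 0)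
    ; 0-homo = coeffwise λ a b c → 0-homo (a ≡ᵇ 0) (b ≡ᵇ 0) (c ≡ᵇ 0)
    ; 1-homo = ≐-refl }
    where
    open import Data.Bool using (Bool; if_then_else_)
    +-homo : ∀ s t x y z → (if x ∧ y ∧ z then s +ℤ t else + 0)
                         ≡ (if x ∧ y ∧ z then s else + 0) +ℤ (if x ∧ y ∧ z then t else + 0)
    +-homo s t x y z with x ∧ y ∧ z
    ... | true  = ≡.refl
    ... | false = ≡.refl
    -‿homo : ∀ s x y z → (if x ∧ y ∧ z then - s else + 0) ≡ - (if x ∧ y ∧ z then s else + 0)
    -‿homo s x y z with x ∧ y ∧ z
    ... | true  = ≡.refl
    ... | false = ≡.refl
    0-homo : ∀ x y z → (if x ∧ y ∧ z then + 0 else + 0) ≡ + 0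
    0-homo x y z with x ∧ y ∧ z
    ... | true  = ≡.refl
    ... | false = ≡.refl

  constant-≟ : ∀ s t → Maybe (constant s ≐ constant t)
  constant-≟ s t with s ℤₚ.≟ t
  ... | yes ≡.refl = just ≐-refl
  ... | no _       = nothing

  open import Algebra.Solver.Ring
    (CommutativeRing.rawRing ℤₚ.+-*-commutativeRing) (fromCommutativeRing PS-commutativeRing)
    constant-homomorphism constant-≟ public

open PS-Solver using (_:=_; _:+_; _:*_; :-_; _:-_; con) renaming (solve to solve-PS)

geom-sumTo : ∀ α β γ a b c K → c ≤ K →
  geom α β (suc γ) a b c ≡ sumTo K (λ r → mono (+ 1) (r * α) (r * β) (r * suc γ) a b c)
geom-sumTo α β γ a b c K c≤K =
  ≡.trans (sumTo-extend (a + b + c) (ℕₚ.m≤n+m c (a + b)) vanish) (≡.sym (sumTo-extend K c≤K vanish))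
  where
  vanish : ∀ r → c < r → mono (+ 1) (r * α) (r * β) (r * suc γ) a b c ≡ + 0
  vanish r c<r = mono-off _ _ _ _ a b c λ { (_ , _ , ≡.refl) →
    ℕₚ.<-irrefl ≡.refl (ℕₚ.<-≤-trans c<r (ℕₚ.m≤m*n r (suc γ))) }

geom-unfold : ∀ α β γ → geom α β (suc γ) ≐ one ⊕ (mono (+ 1) α β (suc γ) ⊛ geom α β (suc γ))
geom-unfold α β γ = coeffwise λ a b c →
  ≡.trans (geom-sumTo α β γ a b c (suc c) (ℕₚ.n≤1+n c))
  (≡.trans (sumTo-unfoldˡ c _) (≡.cong (one a b c +ℤ_) (shifted a b c)))
  where
  shifted : ∀ a b c → sumTo c (λ r → mono (+ 1) (suc r * α) (suc r * β) (suc r * suc γ) a b c)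
          ≡ (mono (+ 1) α β (suc γ) ⊛ geom α β (suc γ)) a b c
  shifted a b c with divides³? α β (suc γ) a b c
  ... | yes d@(α≤a , β≤b , γ<c) = begin
    sumTo c (λ r → mono (+ 1) (α + r * α) (β + r * β) (suc γ + r * suc γ) a b c)
      ≡⟨ sumTo-cong c (λ r _ → ≡.sym (mono-∸ (+ 1) _ _ _ α β (suc γ) α≤a β≤b γ<c)) ⟩
    sumTo c (λ r → mono (+ 1) (r * α) (r * β) (r * suc γ) (a ∸ α) (b ∸ β) (c ∸ suc γ))
      ≡⟨ ≡.sym (geom-sumTo α β γ (a ∸ α) (b ∸ β) (c ∸ suc γ) c (ℕₚ.m∸n≤m c (suc γ))) ⟩
    geom α β (suc γ) (a ∸ α) (b ∸ β) (c ∸ suc γ)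
      ≡⟨ ≡.sym (ℤₚ.*-identityˡ _) ⟩
    + 1 *ℤ geom α β (suc γ) (a ∸ α) (b ∸ β) (c ∸ suc γ)
      ≡⟨ ≡.sym (mono-⊛-coeff (+ 1) α β (suc γ) (geom α β (suc γ)) a b c d) ⟩
    (mono (+ 1) α β (suc γ) ⊛ geom α β (suc γ)) a b c ∎
    where open ≡.≡-Reasoning
  ... | no ∤ = ≡.trans
    (sumTo-zero c (λ r _ → mono-off-∤ _ _ _ _ a b c λ (p , q , s) →
       ∤ (ℕₚ.m+n≤o⇒m≤o α p , ℕₚ.m+n≤o⇒m≤o β q , ℕₚ.m+n≤o⇒m≤o (suc γ) s)))
    (≡.sym (mono-⊛-coeff-∤ (+ 1) α β (suc γ) (geom α β (suc γ)) a b c ∤))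

geom-inverse : ∀ α β γ → (one ⊖ mono (+ 1) α β (suc γ)) ⊛ geom α β (suc γ) ≐ one
geom-inverse α β γ = begin
  (one ⊖ m) ⊛ g              ≈⟨ solve-PS 2 (λ m g → (con (+ 1) :- m) :* g := g :- m :* g) ≐-refl m g ⟩
  g ⊖ (m ⊛ g)                ≈⟨ ⊖-congʳ (m ⊛ g) (geom-unfold α β γ) ⟩
  (one ⊕ (m ⊛ g)) ⊖ (m ⊛ g)  ≈⟨ solve-PS 1 (λ x → (con (+ 1) :+ x) :- x := con (+ 1)) ≐-refl (m ⊛ g) ⟩
  one                        ∎
  where
  open SetoidReasoning ≐-setoid
  m = mono (+ 1) α β (suc γ)
  g = geom α β (suc γ)

geom-nonneg : ∀ α β γ a b c → + 0 ≤ℤ geom α β γ a b c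
geom-nonneg α β γ a b c = sumTo-nonneg (a + b + c) (λ r _ → mono-nonneg 1 _ _ _ a b c)

geom-below : ∀ α β γ a b c → c < suc γ → geom α β (suc γ) a b c ≡ one a b c
geom-below α β γ a b c c<1+γ =
  ≡.trans (geom-sumTo α β γ a b c c ℕₚ.≤-refl) (sumTo-single c z≤n vanish)
  where
  vanish : ∀ r → r ≢ 0 → mono (+ 1) (r * α) (r * β) (r * suc γ) a b c ≡ + 0
  vanish zero    r≢0 = contradiction ≡.refl r≢0
  vanish (suc r) _   = mono-off _ _ _ _ a b c λ { (_ , _ , ≡.refl) →
    ℕₚ.<-irrefl ≡.refl (ℕₚ.<-≤-trans c<1+γ (ℕₚ.m≤m+n (suc γ) (r * suc γ))) }

record Supported (u v : ℕ) (f : PS) : Set where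
  constructor supported
  field vanish : ∀ a b c → c < u * a + v * b → f a b c ≡ + 0
open Supported public

⊛-supported : ∀ {u v f g} → Supported u v f → Supported u v g → Supported u v (f ⊛ g)
⊛-supported {u} {v} {f} {g} (supported f-supp) (supported g-supp) = supported λ a b c c<ua+vb →
  sumTo-zero a λ i i≤a → sumTo-zero b λ j j≤b → sumTo-zero c λ l l≤c → term-zero a b c c<ua+vb i j l i≤a j≤b l≤c
  where
  split : ∀ {a b} i j → i ≤ a → j ≤ b → u * a + v * b ≡ (u * i + v * j) + (u * (a ∸ i) + v * (b ∸ j))
  split {a} {b} i j i≤a j≤b = ≡.trans
    (≡.cong₂ (λ x y → u * x + v * y) (≡.sym (ℕₚ.m+[n∸m]≡n i≤a)) (≡.sym (ℕₚ.m+[n∸m]≡n j≤b)))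
    (distribute u v i j (a ∸ i) (b ∸ j))
    where
    distribute : ∀ u v i j x y → u * (i + x) + v * (j + y) ≡ (u * i + v * j) + (u * x + v * y)
    distribute = solve-∀
  term-zero : ∀ a b c → c < u * a + v * b → ∀ i j l → i ≤ a → j ≤ b → l ≤ c →
              f i j l *ℤ g (a ∸ i) (b ∸ j) (c ∸ l) ≡ + 0
  term-zero a b c c<ua+vb i j l i≤a j≤b l≤c with l <? u * i + v * j
  ... | yes l<ui+vj = ≡.cong (_*ℤ _) (f-supp i j l l<ui+vj)
  ... | no l≮ui+vj = ≡.trans (≡.cong (f i j l *ℤ_) (g-supp (a ∸ i) (b ∸ j) (c ∸ l) c∸l<rest))
                             (ℤₚ.*-zeroʳ (f i j l))
    where
    ui+vj≤l = ℕₚ.≮⇒≥ l≮ui+vj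
    c∸l<rest : c ∸ l < u * (a ∸ i) + v * (b ∸ j)
    c∸l<rest = ℕₚ.≤-<-trans (ℕₚ.∸-monoʳ-≤ c ui+vj≤l)
      (≡.subst (c ∸ (u * i + v * j) <_) (ℕₚ.m+n∸m≡n (u * i + v * j) _)
        (ℕₚ.∸-monoˡ-< (≡.subst (c <_) (split i j i≤a j≤b) c<ua+vb) (ℕₚ.≤-trans ui+vj≤l l≤c)))

⊕-supported : ∀ {u v f g} → Supported u v f → Supported u v g → Supported u v (f ⊕ g)
⊕-supported f-supp g-supp = supported λ a b c lt → ≡.cong₂ _+ℤ_ (vanish f-supp a b c lt) (vanish g-supp a b c lt)

⊖-supported : ∀ {u v f g} → Supported u v f → Supported u v g → Supported u v (f ⊖ g)
⊖-supported f-supp g-supp = supported λ a b c lt → ≡.cong₂ _-ℤ_ (vanish f-supp a b c lt) (vanish g-supp a b c lt)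

mono-supported : ∀ {u v} s α β γ → u * α + v * β ≤ γ → Supported u v (mono s α β γ)
mono-supported s α β γ uα+vβ≤γ = supported λ a b c c<ua+vb →
  mono-off s α β γ a b c λ { (≡.refl , ≡.refl , ≡.refl) → ℕₚ.<⇒≱ c<ua+vb uα+vβ≤γ }

one-supported : ∀ {u v} → Supported u v one
one-supported {u} {v} = mono-supported (+ 1) 0 0 0
  (ℕₚ.≤-reflexive (≡.cong₂ _+_ (ℕₚ.*-zeroʳ u) (ℕₚ.*-zeroʳ v)))

geom-supported : ∀ {u v} α β γ → u * α + v * β ≤ γ → Supported u v (geom α β γ)
geom-supported {u} {v} α β γ uα+vβ≤γ = supported λ a b c c<ua+vb →
  sumTo-zero (a + b + c) λ r _ → mono-off (+ 1) (r * α) (r * β) (r * γ) a b c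
    λ { (≡.refl , ≡.refl , ≡.refl) → ℕₚ.<⇒≱ c<ua+vb
          (≡.subst (_≤ r * γ) (scale r) (ℕₚ.*-monoʳ-≤ r uα+vβ≤γ)) }
  where
  scale : ∀ r → r * (u * α + v * β) ≡ u * (r * α) + v * (r * β)
  scale r = solve (r ∷ u ∷ α ∷ v ∷ β ∷ [])

prod0-supported : ∀ {u v} F n → (∀ i → Supported u v (F i)) → Supported u v (prod0 F n)
prod0-supported F zero    F-supp = one-supported
prod0-supported F (suc n) F-supp = ⊛-supported (prod0-supported F n F-supp) (F-supp n)

prod1-supported : ∀ {u v} F n → (∀ i → Supported u v (F (suc i))) → Supported u v (prod1 F n)
prod1-supported F zero    F-supp = one-supported
prod1-supported F (suc n) F-supp = ⊛-supported (prod1-supported F n F-supp) (F-supp n)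

sumPS-supported : ∀ {u v} F n → (∀ i → Supported u v (F i)) → Supported u v (sumPS F n)
sumPS-supported F zero    F-supp = F-supp 0
sumPS-supported F (suc n) F-supp = ⊕-supported (sumPS-supported F n F-supp) (F-supp (suc n))

module ΣPS = FiniteSums PS-commutativeRing
open ΣPS using (sum≤)

sum≤-coeff : ∀ n (f : ℕ → PS) a b c → sum≤ n f a b c ≡ sumTo n (λ r → f r a b c)
sum≤-coeff zero    f a b c = ≡.refl
sum≤-coeff (suc n) f a b c = ≡.cong (_+ℤ f (suc n) a b c) (sum≤-coeff n f a b c)

record DownSet : Set₁ where
  field
    Member : ℕ → ℕ → ℕ → Set
    closed : ∀ {a b c i j l} → Member a b c → i ≤ a → j ≤ b → l ≤ c → Member i j l

Nonneg : PS → Set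
Nonneg f = ∀ a b c → + 0 ≤ℤ f a b c

module OnDownSet (D : DownSet) where
  open DownSet D

  infix 4 _≐ᴰ_
  record _≐ᴰ_ (f g : PS) : Set where
    constructor coeffwiseᴰ
    field coeffᴰ : ∀ a b c → Member a b c → f a b c ≡ g a b c
  open _≐ᴰ_ public

  NonnegOn : PS → Set
  NonnegOn f = ∀ a b c → Member a b c → + 0 ≤ℤ f a b c

  ≐⇒≐ᴰ : ∀ {f g} → f ≐ g → f ≐ᴰ g
  ≐⇒≐ᴰ f≐g = coeffwiseᴰ λ a b c _ → coeff f≐g a b c

  ≐ᴰ-refl : ∀ {f} → f ≐ᴰ f
  ≐ᴰ-refl = coeffwiseᴰ λ _ _ _ _ → ≡.refl

  ≐ᴰ-sym : ∀ {f g} → f ≐ᴰ g → g ≐ᴰ f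
  ≐ᴰ-sym p = coeffwiseᴰ λ a b c m → ≡.sym (coeffᴰ p a b c m)

  ≐ᴰ-trans : ∀ {f g h} → f ≐ᴰ g → g ≐ᴰ h → f ≐ᴰ h
  ≐ᴰ-trans p q = coeffwiseᴰ λ a b c m → ≡.trans (coeffᴰ p a b c m) (coeffᴰ q a b c m)

  ≐ᴰ-setoid : Setoid 0ℓ 0ℓ
  ≐ᴰ-setoid = record
    { Carrier = PS
    ; _≈_ = _≐ᴰ_
    ; isEquivalence = record { refl = ≐ᴰ-refl ; sym = ≐ᴰ-sym ; trans = ≐ᴰ-trans } }

  ⊕-congᴰ : ∀ {f f′ g g′} → f ≐ᴰ f′ → g ≐ᴰ g′ → f ⊕ g ≐ᴰ f′ ⊕ g′
  ⊕-congᴰ f≐f′ g≐g′ = coeffwiseᴰ λ a b c m →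
    ≡.cong₂ _+ℤ_ (coeffᴰ f≐f′ a b c m) (coeffᴰ g≐g′ a b c m)

  ⊝-congᴰ : ∀ {f f′} → f ≐ᴰ f′ → f ⊝ ≐ᴰ f′ ⊝
  ⊝-congᴰ f≐f′ = coeffwiseᴰ λ a b c m → ≡.cong -_ (coeffᴰ f≐f′ a b c m)

  ⊖-congᴰ : ∀ {f f′ g g′} → f ≐ᴰ f′ → g ≐ᴰ g′ → f ⊖ g ≐ᴰ f′ ⊖ g′
  ⊖-congᴰ f≐f′ g≐g′ = coeffwiseᴰ λ a b c m →
    ≡.cong₂ _-ℤ_ (coeffᴰ f≐f′ a b c m) (coeffᴰ g≐g′ a b c m)

  sum≤-congᴰ : ∀ n {f g : ℕ → PS} → (∀ i → f i ≐ᴰ g i) → sum≤ n f ≐ᴰ sum≤ n g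
  sum≤-congᴰ zero    f≐g = f≐g 0
  sum≤-congᴰ (suc n) f≐g = ⊕-congᴰ (sum≤-congᴰ n f≐g) (f≐g (suc n))

  ⊛-congᴰ : ∀ {f f′ g g′} → f ≐ᴰ f′ → g ≐ᴰ g′ → f ⊛ g ≐ᴰ f′ ⊛ g′
  ⊛-congᴰ f≐f′ g≐g′ = coeffwiseᴰ λ a b c m →
    sumTo-cong a λ i i≤a → sumTo-cong b λ j j≤b → sumTo-cong c λ l l≤c →
      ≡.cong₂ _*ℤ_ (coeffᴰ f≐f′ i j l (closed m i≤a j≤b l≤c))
                   (coeffᴰ g≐g′ (a ∸ i) (b ∸ j) (c ∸ l)
                      (closed m (ℕₚ.m∸n≤m a i) (ℕₚ.m∸n≤m b j) (ℕₚ.m∸n≤m c l)))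

  ⊕-nonnegᴰ : ∀ {f g} → NonnegOn f → NonnegOn g → NonnegOn (f ⊕ g)
  ⊕-nonnegᴰ f≥0 g≥0 a b c m = ℤₚ.+-mono-≤ (f≥0 a b c m) (g≥0 a b c m)

  ⊛-nonnegᴰ : ∀ {f g} → NonnegOn f → NonnegOn g → NonnegOn (f ⊛ g)
  ⊛-nonnegᴰ f≥0 g≥0 a b c m =
    sumTo-nonneg a λ i i≤a → sumTo-nonneg b λ j j≤b → sumTo-nonneg c λ l l≤c →
      *-nonneg (f≥0 i j l (closed m i≤a j≤b l≤c))
               (g≥0 (a ∸ i) (b ∸ j) (c ∸ l) (closed m (ℕₚ.m∸n≤m a i) (ℕₚ.m∸n≤m b j) (ℕₚ.m∸n≤m c l)))
    where
    *-nonneg : ∀ {x y} → + 0 ≤ℤ x → + 0 ≤ℤ y → + 0 ≤ℤ x *ℤ y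
    *-nonneg {+ m} {+ n} _ _ = ≡.subst (+ 0 ≤ℤ_) (ℤₚ.pos-* m n) (ℤ.+≤+ z≤n)

everywhere : DownSet
everywhere = record { Member = λ _ _ _ → ⊤ ; closed = λ _ _ _ _ → tt }

⊛-nonneg : ∀ {f g} → Nonneg f → Nonneg g → Nonneg (f ⊛ g)
⊛-nonneg f≥0 g≥0 a b c = OnDownSet.⊛-nonnegᴰ everywhere (λ a b c _ → f≥0 a b c) (λ a b c _ → g≥0 a b c) a b c tt

⊕-nonneg : ∀ {f g} → Nonneg f → Nonneg g → Nonneg (f ⊕ g)
⊕-nonneg f≥0 g≥0 a b c = ℤₚ.+-mono-≤ (f≥0 a b c) (g≥0 a b c)

prod1-nonneg : ∀ F n → (∀ i → Nonneg (F (suc i))) → Nonneg (prod1 F n)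
prod1-nonneg F zero    F≥0 = mono-nonneg 1 0 0 0
prod1-nonneg F (suc n) F≥0 = ⊛-nonneg (prod1-nonneg F n F≥0) (F≥0 n)

infix 30 q^_
q^_ : ℕ → PS
q^ e = mono (+ 1) 0 0 e

[1-qᴹ]⊛geometric-sum : ∀ k M → (one ⊖ q^ M) ⊛ sum≤ k (λ r → q^ (r * M)) ≐ one ⊖ q^ (suc k * M)
[1-qᴹ]⊛geometric-sum zero M =
  ≐-trans (⊛-identityʳ (one ⊖ q^ M)) (⊖-congˡ one (≡⇒≐ (≡.cong q^_ (≡.sym (ℕₚ.+-identityʳ M)))))
[1-qᴹ]⊛geometric-sum (suc k) M = begin
  (one ⊖ m) ⊛ (S ⊕ w)
    ≈⟨ solve-PS 3 (λ m S w → (con (+ 1) :- m) :* (S :+ w) := (con (+ 1) :- m) :* S :+ (con (+ 1) :- m) :* w)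
                  ≐-refl m S w ⟩
  ((one ⊖ m) ⊛ S) ⊕ ((one ⊖ m) ⊛ w)
    ≈⟨ ⊕-cong ([1-qᴹ]⊛geometric-sum k M) ≐-refl ⟩
  (one ⊖ w) ⊕ ((one ⊖ m) ⊛ w)
    ≈⟨ solve-PS 2 (λ m w → (con (+ 1) :- w) :+ (con (+ 1) :- m) :* w := con (+ 1) :- m :* w) ≐-refl m w ⟩
  one ⊖ (m ⊛ w)
    ≈⟨ ⊖-congˡ one (mono-⊛-mono (+ 1) (+ 1) 0 0 M 0 0 (suc k * M)) ⟩
  one ⊖ q^ (suc (suc k) * M) ∎
  where
  open SetoidReasoning ≐-setoid
  m = q^ M
  S = sum≤ k (λ r → q^ (r * M))
  w = q^ (suc k * M)

qPochInv-suc-⊛ : ∀ k n →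
  qPochInv (suc n) ⊛ (one ⊖ q^ (suc k * suc n)) ≐ qPochInv n ⊛ sum≤ k (λ r → q^ (r * suc n))
qPochInv-suc-⊛ k n = begin
  (Q ⊛ g) ⊛ (one ⊖ q^ (suc k * suc n)) ≈⟨ ⊛-congˡ (Q ⊛ g) (≐-sym ([1-qᴹ]⊛geometric-sum k (suc n))) ⟩
  (Q ⊛ g) ⊛ ((one ⊖ m) ⊛ S)            ≈⟨ solve-PS 4 (λ Q g m S → (Q :* g) :* ((con (+ 1) :- m) :* S)
                                                         := Q :* (((con (+ 1) :- m) :* g) :* S)) ≐-refl Q g m S ⟩
  Q ⊛ (((one ⊖ m) ⊛ g) ⊛ S)            ≈⟨ ⊛-congˡ Q (⊛-congʳ S (geom-inverse 0 0 n)) ⟩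
  Q ⊛ (one ⊛ S)                        ≈⟨ ⊛-congˡ Q (⊛-identityˡ S) ⟩
  Q ⊛ S                                ∎
  where
  open SetoidReasoning ≐-setoid
  Q = qPochInv n
  g = geom 0 0 (suc n)
  m = q^ (suc n)
  S = sum≤ k (λ r → q^ (r * suc n))

prod1-cong : ∀ {F F′ : ℕ → PS} n → (∀ i → F i ≐ F′ i) → prod1 F n ≐ prod1 F′ n
prod1-cong zero    F≐F′ = ≐-refl
prod1-cong (suc n) F≐F′ = ⊛-cong (prod1-cong n F≐F′) (F≐F′ (suc n))

prod1-+ : ∀ (F : ℕ → PS) m n → prod1 F (m + n) ≐ prod1 F m ⊛ prod1 (λ i → F (m + i)) n
prod1-+ F m zero    = ≐-trans (≡⇒≐ (≡.cong (prod1 F) (ℕₚ.+-identityʳ m))) (≐-sym (⊛-identityʳ (prod1 F m)))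
prod1-+ F m (suc n) = begin
  prod1 F (m + suc n)
    ≈⟨ ≡⇒≐ (≡.cong (prod1 F) (ℕₚ.+-suc m n)) ⟩
  prod1 F (m + n) ⊛ F (suc (m + n))
    ≈⟨ ⊛-cong (prod1-+ F m n) (≡⇒≐ (≡.cong F (≡.sym (ℕₚ.+-suc m n)))) ⟩
  (prod1 F m ⊛ prod1 (λ i → F (m + i)) n) ⊛ F (m + suc n)
    ≈⟨ ⊛-assoc (prod1 F m) (prod1 (λ i → F (m + i)) n) (F (m + suc n)) ⟩
  prod1 F m ⊛ prod1 (λ i → F (m + i)) (suc n) ∎
  where open SetoidReasoning ≐-setoid

sumPS-difference : ∀ k {f g : ℕ → PS} (L : ℕ → PS) (h : ℕ → ℕ → PS) → f 0 ≐ g 0 →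
  (∀ n → f (suc n) ⊖ g (suc n) ≐ sum≤ k (λ r → L r ⊛ h r n)) →
  ∀ M → sumPS f M ⊖ sumPS g M ≐ sum≤ k (λ r → L r ⊛ (sumPS (h r) M ⊖ h r M))
sumPS-difference k {f} {g} L h f₀≐g₀ step zero = begin
  f 0 ⊖ g 0                         ≈⟨ ⊖-congʳ (g 0) f₀≐g₀ ⟩
  g 0 ⊖ g 0                         ≈⟨ ⊖-self (g 0) ⟩
  zero-PS                           ≈⟨ ≐-sym (ΣPS.sum≤-zero k) ⟩
  sum≤ k (λ _ → zero-PS)            ≈⟨ ΣPS.sum≤-cong k (λ r _ →
                                         ≐-sym (≐-trans (⊛-congˡ (L r) (⊖-self (h r 0))) (⊛-zeroʳ (L r)))) ⟩
  sum≤ k (λ r → L r ⊛ (h r 0 ⊖ h r 0)) ∎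
  where open SetoidReasoning ≐-setoid
sumPS-difference k {f} {g} L h f₀≐g₀ step (suc M) = begin
  (sumPS f M ⊕ f (suc M)) ⊖ (sumPS g M ⊕ g (suc M))
    ≈⟨ solve-PS 4 (λ F f G g → (F :+ f) :- (G :+ g) := (F :- G) :+ (f :- g))
                  ≐-refl (sumPS f M) (f (suc M)) (sumPS g M) (g (suc M)) ⟩
  (sumPS f M ⊖ sumPS g M) ⊕ (f (suc M) ⊖ g (suc M))
    ≈⟨ ⊕-cong (sumPS-difference k L h f₀≐g₀ step M) (step M) ⟩
  sum≤ k (λ r → L r ⊛ (sumPS (h r) M ⊖ h r M)) ⊕ sum≤ k (λ r → L r ⊛ h r M)
    ≈⟨ ≐-sym (ΣPS.sum≤-+ k _ _) ⟩
  sum≤ k (λ r → (L r ⊛ (sumPS (h r) M ⊖ h r M)) ⊕ (L r ⊛ h r M))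
    ≈⟨ ΣPS.sum≤-cong k (λ r _ → solve-PS 4 (λ L S h h′ → L :* (S :- h) :+ L :* h := L :* ((S :+ h′) :- h′))
                                            ≐-refl (L r) (sumPS (h r) M) (h r M) (h r (suc M))) ⟩
  sum≤ k (λ r → L r ⊛ ((sumPS (h r) M ⊕ h r (suc M)) ⊖ h r (suc M))) ∎
  where open SetoidReasoning ≐-setoid

sumPS-cong : ∀ {f g : ℕ → PS} M → (∀ n → f n ≐ g n) → sumPS f M ≐ sumPS g M
sumPS-cong zero    f≐g = f≐g 0
sumPS-cong (suc M) f≐g = ⊕-cong (sumPS-cong M f≐g) (f≐g (suc M))

-- The positivity argument

module Positivity
  (k N s : ℕ) (ex : ℕ → ℕ → ℕ)
  (ex-suc   : ∀ j n → ex j (suc n) ≡ ex (j + s) n + suc j)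
  (ex-shift : ∀ j n r → ex j n + r * n ≡ ex (j + r) n)
  (ex-lower : ∀ j n → suc j * n ≤ ex j n)
  (F : ℕ → PS)
  where

  K : ℕ
  K = suc k

  zFactor : ℕ → ℕ → PS
  zFactor t i = one ⊖ mono (+ 1) 0 1 (K * (t + i))

  zPochFrom : ℕ → ℕ → PS
  zPochFrom t = prod0 (zFactor t)

  lead : ℕ → ℕ → PS
  lead j n = mono (sgn n) n 0 (ex j n)

  term : ℕ → ℕ → ℕ → PS
  term j t n = lead j n ⊛ (zPochFrom t n ⊛ qPochInv n)

  G : ℕ → ℕ → PS
  G j t = sumPS (term j t) N

  Fprod : ℕ → ℕ → PS
  Fprod j = prod1 (λ i → F (j + i))

  H : ℕ → ℕ → PS
  H j t = Fprod j N ⊛ G j t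

  yzq^ : ℕ → ℕ → ℕ → PS
  yzq^ t j r = mono (+ 1) 1 1 (K * t + suc (j + r))

  yq^ : ℕ → PS
  yq^ j = mono (+ 1) 1 0 (suc j)

  zPochFrom-unfoldˡ : ∀ t n → zPochFrom t (suc n) ≐ zFactor t 0 ⊛ zPochFrom (suc t) n
  zPochFrom-unfoldˡ t zero    = ⊛-comm one (zFactor t 0)
  zPochFrom-unfoldˡ t (suc n) = begin
    zPochFrom t (suc n) ⊛ zFactor t (suc n)
      ≈⟨ ⊛-cong (zPochFrom-unfoldˡ t n) (≡⇒≐ (≡.cong (λ e → one ⊖ mono (+ 1) 0 1 (K * e)) (ℕₚ.+-suc t n))) ⟩
    (zFactor t 0 ⊛ zPochFrom (suc t) n) ⊛ zFactor (suc t) n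
      ≈⟨ ⊛-assoc (zFactor t 0) (zPochFrom (suc t) n) (zFactor (suc t) n) ⟩
    zFactor t 0 ⊛ zPochFrom (suc t) (suc n) ∎
    where open SetoidReasoning ≐-setoid

  zPochFrom-difference : ∀ t n →
    zPochFrom t (suc n) ⊖ zPochFrom (suc t) (suc n)
      ≐ ((mono (+ 1) 0 1 (K * (t + 0)) ⊛ zPochFrom (suc t) n) ⊛ (one ⊖ q^ (K * suc n))) ⊝
  zPochFrom-difference t n = begin
    zPochFrom t (suc n) ⊖ zPochFrom (suc t) (suc n)
      ≈⟨ ⊖-congʳ (zPochFrom (suc t) (suc n)) (zPochFrom-unfoldˡ t n) ⟩
    ((one ⊖ z₀) ⊛ X) ⊖ (X ⊛ (one ⊖ zₙ))
      ≈⟨ ⊖-congˡ ((one ⊖ z₀) ⊛ X) (⊛-congˡ X (⊖-congˡ one zₙ≐z₀⊛qᴷ)) ⟩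
    ((one ⊖ z₀) ⊛ X) ⊖ (X ⊛ (one ⊖ (z₀ ⊛ q^ (K * suc n))))
      ≈⟨ solve-PS 3 (λ z₀ X m → ((con (+ 1) :- z₀) :* X) :- (X :* (con (+ 1) :- z₀ :* m))
                               := :- ((z₀ :* X) :* (con (+ 1) :- m))) ≐-refl z₀ X (q^ (K * suc n)) ⟩
    ((z₀ ⊛ X) ⊛ (one ⊖ q^ (K * suc n))) ⊝ ∎
    where
    open SetoidReasoning ≐-setoid
    X  = zPochFrom (suc t) n
    z₀ = mono (+ 1) 0 1 (K * (t + 0))
    zₙ = mono (+ 1) 0 1 (K * (suc t + n))
    zₙ≐z₀⊛qᴷ : zₙ ≐ z₀ ⊛ q^ (K * suc n)
    zₙ≐z₀⊛qᴷ = ≐-trans (mono-cong ≡.refl ≡.refl ≡.refl (distribute K t n))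
                       (≐-sym (mono-⊛-mono (+ 1) (+ 1) 0 1 (K * (t + 0)) 0 0 (K * suc n)))
      where
      distribute : ∀ K t n → K * (suc t + n) ≡ K * (t + 0) + K * suc n
      distribute = solve-∀

  lead-shift-t : ∀ j t n r →
    q^ (r * suc n) ⊛ ((lead j (suc n) ⊛ mono (+ 1) 0 1 (K * (t + 0))) ⊝) ≐ yzq^ t j r ⊛ lead (j + s + r) n
  lead-shift-t j t n r = begin
    q^ (r * suc n) ⊛ ((lead j (suc n) ⊛ mono (+ 1) 0 1 (K * (t + 0))) ⊝)
      ≈⟨ ⊛-congˡ (q^ (r * suc n))
           (≐-trans (⊝-cong (mono-⊛-mono (sgn (suc n)) (+ 1) (suc n) 0 (ex j (suc n)) 0 1 (K * (t + 0))))
                    (≐-sym (mono-⊝ _ _ _ _))) ⟩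
    q^ (r * suc n) ⊛ mono (- (sgn (suc n) *ℤ + 1)) (suc n + 0) 1 (ex j (suc n) + K * (t + 0))
      ≈⟨ mono-⊛-mono (+ 1) _ 0 0 (r * suc n) (suc n + 0) 1 (ex j (suc n) + K * (t + 0)) ⟩
    mono (+ 1 *ℤ - (sgn (suc n) *ℤ + 1)) (suc n + 0) 1 (r * suc n + (ex j (suc n) + K * (t + 0)))
      ≈⟨ mono-cong (sign (sgn n)) (ℕₚ.+-identityʳ (suc n)) ≡.refl exponent ⟩
    mono (+ 1 *ℤ sgn n) (1 + n) (1 + 0) (K * t + suc (j + r) + ex (j + s + r) n)
      ≈⟨ ≐-sym (mono-⊛-mono (+ 1) (sgn n) 1 1 (K * t + suc (j + r)) n 0 (ex (j + s + r) n)) ⟩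
    yzq^ t j r ⊛ lead (j + s + r) n ∎
    where
    open SetoidReasoning ≐-setoid
    sign : ∀ x → + 1 *ℤ - (- x *ℤ + 1) ≡ + 1 *ℤ x
    sign = ℤ-solve-∀
    exponent : r * suc n + (ex j (suc n) + K * (t + 0)) ≡ K * t + suc (j + r) + ex (j + s + r) n
    exponent rewrite ex-suc j n | ≡.sym (ex-shift (j + s) n r) = rearrange (ex (j + s) n) j K t r n
      where
      rearrange : ∀ E j K t r n → r * suc n + (E + suc j + K * (t + 0)) ≡ K * t + suc (j + r) + (E + r * n)
      rearrange = solve-∀

  term-t-difference : ∀ j t n →
    term j t (suc n) ⊖ term j (suc t) (suc n) ≐ sum≤ k (λ r → yzq^ t j r ⊛ term (j + s + r) (suc t) n)
  term-t-difference j t n = begin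
    (ℓ ⊛ (zPochFrom t (suc n) ⊛ Q₁)) ⊖ (ℓ ⊛ (zPochFrom (suc t) (suc n) ⊛ Q₁))
      ≈⟨ solve-PS 4 (λ ℓ Z Z′ Q → (ℓ :* (Z :* Q)) :- (ℓ :* (Z′ :* Q)) := ℓ :* ((Z :- Z′) :* Q))
                    ≐-refl ℓ (zPochFrom t (suc n)) (zPochFrom (suc t) (suc n)) Q₁ ⟩
    ℓ ⊛ ((zPochFrom t (suc n) ⊖ zPochFrom (suc t) (suc n)) ⊛ Q₁)
      ≈⟨ ⊛-congˡ ℓ (⊛-congʳ Q₁ (zPochFrom-difference t n)) ⟩
    ℓ ⊛ ((((z ⊛ X) ⊛ (one ⊖ qᴷ)) ⊝) ⊛ Q₁)
      ≈⟨ solve-PS 5 (λ ℓ z X m Q → ℓ :* ((:- ((z :* X) :* (con (+ 1) :- m))) :* Q)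
                                := (:- (ℓ :* z) :* X) :* (Q :* (con (+ 1) :- m))) ≐-refl ℓ z X qᴷ Q₁ ⟩
    (((ℓ ⊛ z) ⊝) ⊛ X) ⊛ (Q₁ ⊛ (one ⊖ qᴷ))
      ≈⟨ ⊛-congˡ (((ℓ ⊛ z) ⊝) ⊛ X) (qPochInv-suc-⊛ k n) ⟩
    (((ℓ ⊛ z) ⊝) ⊛ X) ⊛ (qPochInv n ⊛ S)
      ≈⟨ solve-PS 4 (λ m X Q S → (m :* X) :* (Q :* S) := S :* (m :* (X :* Q))) ≐-refl ((ℓ ⊛ z) ⊝) X (qPochInv n) S ⟩
    S ⊛ (((ℓ ⊛ z) ⊝) ⊛ (X ⊛ qPochInv n))
      ≈⟨ ΣPS.*-distribʳ-sum≤ k (((ℓ ⊛ z) ⊝) ⊛ (X ⊛ qPochInv n)) (λ r → q^ (r * suc n)) ⟩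
    sum≤ k (λ r → q^ (r * suc n) ⊛ (((ℓ ⊛ z) ⊝) ⊛ (X ⊛ qPochInv n)))
      ≈⟨ ΣPS.sum≤-cong k (λ r _ → shift r) ⟩
    sum≤ k (λ r → yzq^ t j r ⊛ term (j + s + r) (suc t) n) ∎
    where
    open SetoidReasoning ≐-setoid
    ℓ  = lead j (suc n)
    Q₁ = qPochInv (suc n)
    X  = zPochFrom (suc t) n
    z  = mono (+ 1) 0 1 (K * (t + 0))
    qᴷ = q^ (K * suc n)
    S  = sum≤ k (λ r → q^ (r * suc n))
    shift : ∀ r → q^ (r * suc n) ⊛ (((ℓ ⊛ z) ⊝) ⊛ (X ⊛ qPochInv n))
                ≐ yzq^ t j r ⊛ term (j + s + r) (suc t) n
    shift r = ≐-trans (≐-sym (⊛-assoc (q^ (r * suc n)) ((ℓ ⊛ z) ⊝) (X ⊛ qPochInv n)))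
             (≐-trans (⊛-congʳ (X ⊛ qPochInv n) (lead-shift-t j t n r))
                      (⊛-assoc (yzq^ t j r) (lead (j + s + r) n) (X ⊛ qPochInv n)))

  lead-suc : ∀ j n → lead j (suc n) ≐ (yq^ j ⊛ lead (j + s) n) ⊝
  lead-suc j n = begin
    mono (- sgn n) (suc n) 0 (ex j (suc n))
      ≈⟨ mono-cong (≡.cong -_ (≡.sym (ℤₚ.*-identityˡ (sgn n)))) ≡.refl ≡.refl
                   (≡.trans (ex-suc j n) (ℕₚ.+-comm (ex (j + s) n) (suc j))) ⟩
    mono (- (+ 1 *ℤ sgn n)) (1 + n) (0 + 0) (suc j + ex (j + s) n)
      ≈⟨ mono-⊝ _ _ _ _ ⟩
    mono (+ 1 *ℤ sgn n) (1 + n) (0 + 0) (suc j + ex (j + s) n) ⊝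
      ≈⟨ ⊝-cong (≐-sym (mono-⊛-mono (+ 1) (sgn n) 1 0 (suc j) n 0 (ex (j + s) n))) ⟩
    (yq^ j ⊛ lead (j + s) n) ⊝ ∎
    where open SetoidReasoning ≐-setoid

  lead-j-suc : ∀ j n → lead (suc j) n ≐ lead j n ⊛ q^ n
  lead-j-suc j n = ≐-trans
    (mono-cong (≡.sym (ℤₚ.*-identityʳ (sgn n))) (≡.sym (ℕₚ.+-identityʳ n)) ≡.refl
       (≡.trans (≡.cong (λ i → ex i n) (ℕₚ.+-comm 1 j))
       (≡.trans (≡.sym (ex-shift j n 1)) (≡.cong (_+_ (ex j n)) (ℕₚ.*-identityˡ n)))))
    (≐-sym (mono-⊛-mono (sgn n) (+ 1) n 0 (ex j n) 0 0 n))

  term-j-difference : ∀ j t n →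
    term j t (suc n) ⊖ term (suc j) t (suc n) ≐ ((yq^ j ⊛ zFactor t 0) ⊝) ⊛ term (j + s) (suc t) n
  term-j-difference j t n = begin
    (ℓ ⊛ (Z ⊛ (Q ⊛ g))) ⊖ (lead (suc j) (suc n) ⊛ (Z ⊛ (Q ⊛ g)))
      ≈⟨ ⊖-congˡ (ℓ ⊛ (Z ⊛ (Q ⊛ g))) (⊛-congʳ (Z ⊛ (Q ⊛ g)) (lead-j-suc j (suc n))) ⟩
    (ℓ ⊛ (Z ⊛ (Q ⊛ g))) ⊖ ((ℓ ⊛ q^ (suc n)) ⊛ (Z ⊛ (Q ⊛ g)))
      ≈⟨ solve-PS 5 (λ ℓ Z Q g m → (ℓ :* (Z :* (Q :* g))) :- ((ℓ :* m) :* (Z :* (Q :* g)))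
                                := (ℓ :* (Z :* Q)) :* ((con (+ 1) :- m) :* g)) ≐-refl ℓ Z Q g (q^ (suc n)) ⟩
    (ℓ ⊛ (Z ⊛ Q)) ⊛ ((one ⊖ q^ (suc n)) ⊛ g)
      ≈⟨ ≐-trans (⊛-congˡ (ℓ ⊛ (Z ⊛ Q)) (geom-inverse 0 0 n)) (⊛-identityʳ (ℓ ⊛ (Z ⊛ Q))) ⟩
    ℓ ⊛ (Z ⊛ Q)
      ≈⟨ ⊛-cong (lead-suc j n) (⊛-congʳ Q (zPochFrom-unfoldˡ t n)) ⟩
    ((yq^ j ⊛ lead (j + s) n) ⊝) ⊛ ((zFactor t 0 ⊛ X) ⊛ Q)
      ≈⟨ solve-PS 5 (λ y ℓ′ f X Q → (:- (y :* ℓ′)) :* ((f :* X) :* Q) := (:- (y :* f)) :* (ℓ′ :* (X :* Q)))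
                    ≐-refl (yq^ j) (lead (j + s) n) (zFactor t 0) X Q ⟩
    ((yq^ j ⊛ zFactor t 0) ⊝) ⊛ term (j + s) (suc t) n ∎
    where
    open SetoidReasoning ≐-setoid
    ℓ = lead j (suc n)
    Z = zPochFrom t (suc n)
    Q = qPochInv n
    g = geom 0 0 (suc n)
    X = zPochFrom (suc t) n

  G-t-difference : ∀ j t →
    G j t ⊖ G j (suc t) ≐ sum≤ k (λ r → yzq^ t j r ⊛ (G (j + s + r) (suc t) ⊖ term (j + s + r) (suc t) N))
  G-t-difference j t =
    sumPS-difference k (yzq^ t j) (λ r → term (j + s + r) (suc t)) ≐-refl (term-t-difference j t) N

  G-j-difference : ∀ j t →
    G j t ⊖ G (suc j) t ≐ ((yq^ j ⊛ zFactor t 0) ⊝) ⊛ (G (j + s) (suc t) ⊖ term (j + s) (suc t) N)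
  G-j-difference j t =
    sumPS-difference 0 (λ _ → (yq^ j ⊛ zFactor t 0) ⊝) (λ _ → term (j + s) (suc t))
      (⊛-congʳ (zPochFrom t 0 ⊛ qPochInv 0) (mono-cong ≡.refl ≡.refl ≡.refl ex-at-0))
      (term-j-difference j t) N
    where
    ex-at-0 : ex j 0 ≡ ex (suc j) 0
    ex-at-0 = ≡.trans (≡.sym (ℕₚ.+-identityʳ (ex j 0)))
              (≡.trans (ex-shift j 0 1) (≡.cong (λ i → ex i 0) (ℕₚ.+-comm j 1)))

  -- the coefficients unaffected by truncating at N
  lowDegree : DownSet
  lowDegree = record
    { Member = λ a b c → a + c ≤ N
    ; closed = λ a+c≤N i≤a _ l≤c → ℕₚ.≤-trans (ℕₚ.+-mono-≤ i≤a l≤c) a+c≤N }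

  open OnDownSet lowDegree public using ()
    renaming ( _≐ᴰ_ to _≐ᴺ_; coeffᴰ to coeffᴺ; ≐⇒≐ᴰ to ≐⇒≐ᴺ; ≐ᴰ-refl to ≐ᴺ-refl; ≐ᴰ-sym to ≐ᴺ-sym
             ; ≐ᴰ-trans to ≐ᴺ-trans; ≐ᴰ-setoid to ≐ᴺ-setoid; ⊕-congᴰ to ⊕-congᴺ
             ; ⊖-congᴰ to ⊖-congᴺ; ⊛-congᴰ to ⊛-congᴺ; sum≤-congᴰ to sum≤-congᴺ)

  y^1⊛term-N≐ᴺ0 : ∀ β γ j t → mono (+ 1) 1 β γ ⊛ term j t N ≐ᴺ zero-PS
  y^1⊛term-N≐ᴺ0 β γ j t = OnDownSet.coeffwiseᴰ λ a b c a+c≤N → ≡.trans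
    (coeff (≐-trans (≐-sym (⊛-assoc (mono (+ 1) 1 β γ) (lead j N) (zPochFrom t N ⊛ qPochInv N)))
                    (⊛-congʳ (zPochFrom t N ⊛ qPochInv N) (mono-⊛-mono (+ 1) (sgn N) 1 β γ N 0 (ex j N)))) a b c)
    (mono-⊛-coeff-∤ (+ 1 *ℤ sgn N) (1 + N) (β + 0) (γ + ex j N) (zPochFrom t N ⊛ qPochInv N) a b c
       λ (N<a , _) → ℕₚ.<⇒≱ (s≤s (ℕₚ.m+n≤o⇒m≤o a a+c≤N)) N<a)

  z⁰lowDegree : DownSet
  z⁰lowDegree = record
    { Member = λ a b c → a + c ≤ N × b ≡ 0
    ; closed = λ { (a+c≤N , ≡.refl) i≤a z≤n l≤c → ℕₚ.≤-trans (ℕₚ.+-mono-≤ i≤a l≤c) a+c≤N , ≡.refl } }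

  open OnDownSet z⁰lowDegree public using ()
    renaming ( _≐ᴰ_ to _≐⁰_; coeffwiseᴰ to coeffwise⁰; coeffᴰ to coeff⁰; ≐⇒≐ᴰ to ≐⇒≐⁰; ≐ᴰ-refl to ≐⁰-refl
             ; ≐ᴰ-trans to ≐⁰-trans; ≐ᴰ-setoid to ≐⁰-setoid; ⊕-congᴰ to ⊕-cong⁰; ⊝-congᴰ to ⊝-cong⁰
             ; ⊛-congᴰ to ⊛-cong⁰)

  ≐ᴺ⇒≐⁰ : ∀ {f g} → f ≐ᴺ g → f ≐⁰ g
  ≐ᴺ⇒≐⁰ f≐g = coeffwise⁰ λ a b c (a+c≤N , _) → coeffᴺ f≐g a b c a+c≤N

  one⊕yq^-cancel : ∀ γ {f g} → (one ⊕ mono (+ 1) 1 0 γ) ⊛ f ≐⁰ (one ⊕ mono (+ 1) 1 0 γ) ⊛ g → f ≐⁰ g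
  one⊕yq^-cancel γ {f} {g} eq = coeffwise⁰ λ { a b c (a+c≤N , ≡.refl) → cancel a c a+c≤N }
    where
    m = mono (+ 1) 1 0 γ
    expand : ∀ h a c → ((one ⊕ m) ⊛ h) a 0 c ≡ h a 0 c +ℤ (m ⊛ h) a 0 c
    expand h a c = coeff (solve-PS 2 (λ m h → (con (+ 1) :+ m) :* h := h :+ m :* h) ≐-refl m h) a 0 c
    -- the coefficient of y^a in (1 + y q^γ) h involves h only at y^a and y^(a-1)
    cancel : ∀ a c → a + c ≤ N → f a 0 c ≡ g a 0 c
    lower  : ∀ a c → a + c ≤ N → (m ⊛ f) a 0 c ≡ (m ⊛ g) a 0 c
    cancel a c a+c≤N = ∙-cancelʳ ((m ⊛ g) a 0 c) (f a 0 c) (g a 0 c)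
      (≡.trans (≡.cong (f a 0 c +ℤ_) (≡.sym (lower a c a+c≤N)))
      (≡.trans (≡.sym (expand f a c)) (≡.trans (coeff⁰ eq a 0 c (a+c≤N , ≡.refl)) (expand g a c))))
    lower zero c _ = ≡.trans (mono-⊛-coeff-∤ (+ 1) 1 0 γ f 0 0 c λ { (() , _) })
                             (≡.sym (mono-⊛-coeff-∤ (+ 1) 1 0 γ g 0 0 c λ { (() , _) }))
    lower (suc a) c 1+a+c≤N with γ ≤? c
    ... | no γ≰c = ≡.trans (mono-⊛-coeff-∤ (+ 1) 1 0 γ f (suc a) 0 c λ (_ , _ , γ≤c) → γ≰c γ≤c)
                           (≡.sym (mono-⊛-coeff-∤ (+ 1) 1 0 γ g (suc a) 0 c λ (_ , _ , γ≤c) → γ≰c γ≤c))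
    ... | yes γ≤c =
      ≡.trans (mono-⊛-coeff (+ 1) 1 0 γ f (suc a) 0 c (s≤s z≤n , z≤n , γ≤c))
      (≡.trans (≡.cong (+ 1 *ℤ_) (cancel a (c ∸ γ)
                 (ℕₚ.≤-trans (ℕₚ.+-mono-≤ (ℕₚ.n≤1+n a) (ℕₚ.m∸n≤m c γ)) 1+a+c≤N)))
      (≡.sym (mono-⊛-coeff (+ 1) 1 0 γ g (suc a) 0 c (s≤s z≤n , z≤n , γ≤c))))

  module WithFactorBounds
    (F-nonneg    : ∀ i → Nonneg (F i))
    (F-trivial   : ∀ i → N < i → F i ≐ᴺ one)
    (F-supported : ∀ u v i → u ≤ i → Supported u v (F i))
    where

    Fprod-split : ∀ j d → Fprod j N ≐ᴺ Fprod j d ⊛ Fprod (j + d) N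
    Fprod-split j d = ≐ᴺ-sym (begin
      Fprod j d ⊛ Fprod (j + d) N
        ≈⟨ ≐⇒≐ᴺ (⊛-congˡ (Fprod j d) (prod1-cong N (λ i → ≡⇒≐ (≡.cong F (ℕₚ.+-assoc j d i))))) ⟩
      prod1 f d ⊛ prod1 (λ i → f (d + i)) N
        ≈⟨ ≐⇒≐ᴺ (≐-trans (≐-sym (prod1-+ f d N)) (≡⇒≐ (≡.cong (prod1 f) (ℕₚ.+-comm d N)))) ⟩
      prod1 f (N + d)
        ≈⟨ ≐⇒≐ᴺ (prod1-+ f N d) ⟩
      prod1 f N ⊛ prod1 (λ i → f (N + i)) d
        ≈⟨ ⊛-congᴺ (≐ᴺ-refl {prod1 f N}) (trivial d) ⟩
      prod1 f N ⊛ one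
        ≈⟨ ≐⇒≐ᴺ (⊛-identityʳ (prod1 f N)) ⟩
      Fprod j N ∎)
      where
      open SetoidReasoning ≐ᴺ-setoid
      f = λ i → F (j + i)
      trivial : ∀ d → prod1 (λ i → f (N + i)) d ≐ᴺ one
      trivial zero    = ≐ᴺ-refl
      trivial (suc d) = ≐ᴺ-trans (⊛-congᴺ (trivial d) (F-trivial (j + (N + suc d)) N<))
                                  (≐⇒≐ᴺ (⊛-identityˡ one))
        where
        N< : N < j + (N + suc d)
        N< = ℕₚ.<-≤-trans (ℕₚ.≤-trans (s≤s (ℕₚ.m≤m+n N d)) (ℕₚ.≤-reflexive (≡.sym (ℕₚ.+-suc N d))))
                          (ℕₚ.m≤n+m (N + suc d) j)

    H-t-recurrence : ∀ j t →
      H j t ≐ᴺ H j (suc t) ⊕ sum≤ k (λ r → yzq^ t j r ⊛ (Fprod j (s + r) ⊛ H (j + s + r) (suc t)))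
    H-t-recurrence j t = begin
      P ⊛ G j t
        ≈⟨ ≐⇒≐ᴺ (solve-PS 3 (λ P g g′ → P :* g := P :* g′ :+ P :* (g :- g′)) ≐-refl P (G j t) (G j (suc t))) ⟩
      H j (suc t) ⊕ (P ⊛ (G j t ⊖ G j (suc t)))
        ≈⟨ ≐⇒≐ᴺ (⊕-congˡ (H j (suc t))
                  (≐-trans (⊛-congˡ P (G-t-difference j t)) (ΣPS.*-distribˡ-sum≤ k P _))) ⟩
      H j (suc t) ⊕ sum≤ k (λ r → P ⊛ (m r ⊛ (G′ r ⊖ τ r)))
        ≈⟨ ⊕-congᴺ (≐ᴺ-refl {H j (suc t)}) (sum≤-congᴺ k summand) ⟩
      H j (suc t) ⊕ sum≤ k (λ r → m r ⊛ (Fprod j (s + r) ⊛ H (j + s + r) (suc t))) ∎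
      where
      open SetoidReasoning ≐ᴺ-setoid
      P  = Fprod j N
      m  = yzq^ t j
      G′ = λ r → G (j + s + r) (suc t)
      τ  = λ r → term (j + s + r) (suc t) N
      summand : ∀ r → P ⊛ (m r ⊛ (G′ r ⊖ τ r)) ≐ᴺ m r ⊛ (Fprod j (s + r) ⊛ H (j + s + r) (suc t))
      summand r = begin
        P ⊛ (m r ⊛ (G′ r ⊖ τ r))
          ≈⟨ ≐⇒≐ᴺ (solve-PS 4 (λ P m g τ → P :* (m :* (g :- τ)) := m :* (P :* g) :- P :* (m :* τ))
                               ≐-refl P (m r) (G′ r) (τ r)) ⟩
        (m r ⊛ (P ⊛ G′ r)) ⊖ (P ⊛ (m r ⊛ τ r))
          ≈⟨ ⊖-congᴺ (≐ᴺ-refl {m r ⊛ (P ⊛ G′ r)})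
                     (⊛-congᴺ (≐ᴺ-refl {P}) (y^1⊛term-N≐ᴺ0 1 _ (j + s + r) (suc t))) ⟩
        (m r ⊛ (P ⊛ G′ r)) ⊖ (P ⊛ zero-PS)
          ≈⟨ ≐⇒≐ᴺ (≐-trans (⊖-congˡ (m r ⊛ (P ⊛ G′ r)) (⊛-zeroʳ P))
                           (⊖-identityʳ (m r ⊛ (P ⊛ G′ r)))) ⟩
        m r ⊛ (P ⊛ G′ r)
          ≈⟨ ⊛-congᴺ (≐ᴺ-refl {m r}) (⊛-congᴺ (Fprod-split j (s + r)) (≐ᴺ-refl {G′ r})) ⟩
        m r ⊛ ((Fprod j (s + r) ⊛ Fprod (j + (s + r)) N) ⊛ G′ r)
          ≈⟨ ≐⇒≐ᴺ (⊛-congˡ (m r) (≐-trans (⊛-assoc (Fprod j (s + r)) (Fprod (j + (s + r)) N) (G′ r))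
               (⊛-congˡ (Fprod j (s + r))
                 (⊛-congʳ (G′ r) (≡⇒≐ (≡.cong (λ i → Fprod i N) (≡.sym (ℕₚ.+-assoc j s r)))))))) ⟩
        m r ⊛ (Fprod j (s + r) ⊛ H (j + s + r) (suc t)) ∎

    H-supported : ∀ j t → Supported (suc j) (K * t) (H j t)
    H-supported j t =
      ⊛-supported (prod1-supported (λ i → F (j + i)) N λ i → F-supported u v (j + suc i) u≤j+1+i)
                  (sumPS-supported (term j t) N λ n →
                     ⊛-supported (mono-supported (sgn n) n 0 (ex j n) (lead-bound n))
                                 (⊛-supported (prod0-supported (zFactor t) n λ i →
                                                 ⊖-supported one-supported (mono-supported (+ 1) 0 1 _ (z-bound i)))
                                              (prod1-supported (λ i → geom 0 0 i) n λ i →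
                                                 geom-supported 0 0 (suc i) q-bound)))
      where
      u = suc j
      v = K * t
      u≤j+1+i : ∀ {i} → u ≤ j + suc i
      u≤j+1+i {i} = ℕₚ.≤-trans (s≤s (ℕₚ.m≤m+n j i)) (ℕₚ.≤-reflexive (≡.sym (ℕₚ.+-suc j i)))
      lead-bound : ∀ n → u * n + v * 0 ≤ ex j n
      lead-bound n rewrite ℕₚ.*-zeroʳ v | ℕₚ.+-identityʳ (u * n) = ex-lower j n
      z-bound : ∀ i → u * 0 + v * 1 ≤ K * (t + i)
      z-bound i rewrite ℕₚ.*-zeroʳ u | ℕₚ.*-identityʳ v = ℕₚ.*-monoʳ-≤ K (ℕₚ.m≤m+n t i)
      q-bound : ∀ {i} → u * 0 + v * 0 ≤ suc i
      q-bound rewrite ℕₚ.*-zeroʳ u | ℕₚ.*-zeroʳ v = z≤n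

    H-y⁰-nonneg : ∀ j t b c → + 0 ≤ℤ H j t 0 b c
    H-y⁰-nonneg j t b c = ⊛-nonneg⁰ (λ a b c _ → Fprod-nonneg a b c) (G-nonneg N) 0 b c ≡.refl
      where
      y⁰ : DownSet
      y⁰ = record { Member = λ a _ _ → a ≡ 0 ; closed = λ { ≡.refl z≤n _ _ → ≡.refl } }
      open OnDownSet y⁰ using () renaming (NonnegOn to Nonneg⁰; ⊛-nonnegᴰ to ⊛-nonneg⁰; ⊕-nonnegᴰ to ⊕-nonneg⁰)
      Fprod-nonneg : Nonneg (Fprod j N)
      Fprod-nonneg = prod1-nonneg (λ i → F (j + i)) N (λ i → F-nonneg (j + suc i))
      term-nonneg : ∀ n → Nonneg⁰ (term j t n)
      term-nonneg zero    a b c _ =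
        ⊛-nonneg (mono-nonneg 1 0 0 (ex j 0)) (⊛-nonneg (mono-nonneg 1 0 0 0) (mono-nonneg 1 0 0 0)) a b c
      term-nonneg (suc n) a b c ≡.refl = ℤₚ.≤-reflexive (≡.sym
        (mono-⊛-coeff-∤ (sgn (suc n)) (suc n) 0 (ex j (suc n)) (zPochFrom t (suc n) ⊛ qPochInv (suc n)) 0 b c
           λ { (() , _) }))
      G-nonneg : ∀ M → Nonneg⁰ (sumPS (term j t) M)
      G-nonneg zero    = term-nonneg 0
      G-nonneg (suc M) = ⊕-nonneg⁰ (G-nonneg M) (term-nonneg (suc M))

    H-z⁰-t-invariant : ∀ j t → H j (suc t) ≐⁰ H j t
    H-z⁰-t-invariant j t = coeffwise⁰ λ { a b c (a+c≤N , ≡.refl) → ≡.sym (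
      ≡.trans (coeffᴺ (H-t-recurrence j t) a 0 c a+c≤N)
      (≡.trans (≡.cong (H j (suc t) a 0 c +ℤ_) (≡.trans (sum≤-coeff k _ a 0 c) (sumTo-zero k λ r _ →
         mono-⊛-coeff-∤ (+ 1) 1 1 (K * t + suc (j + r)) (Fprod j (s + r) ⊛ H (j + s + r) (suc t)) a 0 c
           λ { (_ , () , _) })))
      (ℤₚ.+-identityʳ _))) }

    Fprod-peel : ∀ j g → Fprod j N ⊛ g ≐ᴺ F (suc j) ⊛ (Fprod (suc j) N ⊛ g)
    Fprod-peel j g = ≐ᴺ-trans (⊛-congᴺ (Fprod-split j 1) (≐ᴺ-refl {g})) (≐⇒≐ᴺ (begin
      (Fprod j 1 ⊛ Fprod (j + 1) N) ⊛ g   ≈⟨ ⊛-assoc (Fprod j 1) (Fprod (j + 1) N) g ⟩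
      (one ⊛ F (j + 1)) ⊛ (Fprod (j + 1) N ⊛ g)
        ≈⟨ ⊛-cong (≐-trans (⊛-identityˡ (F (j + 1))) (≡⇒≐ (≡.cong F j+1≡1+j)))
                  (⊛-congʳ g (≡⇒≐ (≡.cong (λ i → Fprod i N) j+1≡1+j))) ⟩
      F (suc j) ⊛ (Fprod (suc j) N ⊛ g) ∎))
      where
      open SetoidReasoning ≐-setoid
      j+1≡1+j = ℕₚ.+-comm j 1

    H-j-difference : ∀ j t →
      H j t ⊖ (Fprod j N ⊛ G (suc j) t) ≐⁰ (yq^ j ⊛ (Fprod j N ⊛ G (j + s) (suc t))) ⊝
    H-j-difference j t = begin
      H j t ⊖ (P ⊛ G (suc j) t)
        ≈⟨ ≐⇒≐⁰ (solve-PS 3 (λ P g g′ → P :* g :- P :* g′ := P :* (g :- g′)) ≐-refl P (G j t) (G (suc j) t)) ⟩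
      P ⊛ (G j t ⊖ G (suc j) t)
        ≈⟨ ≐⇒≐⁰ (⊛-congˡ P (G-j-difference j t)) ⟩
      P ⊛ (((y ⊛ (one ⊖ z)) ⊝) ⊛ (G′ ⊖ τ))
        ≈⟨ ≐⇒≐⁰ (solve-PS 5 (λ P y z G τ → P :* ((:- (y :* (con (+ 1) :- z))) :* (G :- τ))
                   := ((:- (y :* (P :* G))) :+ (z :* (y :* (P :* G)))) :+ (((con (+ 1) :- z) :* P) :* (y :* τ)))
                 ≐-refl P y z G′ τ) ⟩
      (((y ⊛ (P ⊛ G′)) ⊝) ⊕ (z ⊛ (y ⊛ (P ⊛ G′)))) ⊕ (((one ⊖ z) ⊛ P) ⊛ (y ⊛ τ))
        ≈⟨ ⊕-cong⁰ (⊕-cong⁰ (≐⁰-refl {(y ⊛ (P ⊛ G′)) ⊝}) z-multiple)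
                   (⊛-cong⁰ (≐⁰-refl {(one ⊖ z) ⊛ P})
                            (≐ᴺ⇒≐⁰ (y^1⊛term-N≐ᴺ0 0 (suc j) (j + s) (suc t)))) ⟩
      (((y ⊛ (P ⊛ G′)) ⊝) ⊕ zero-PS) ⊕ (((one ⊖ z) ⊛ P) ⊛ zero-PS)
        ≈⟨ ≐⇒≐⁰ (≐-trans (⊕-cong (⊕-identityʳ ((y ⊛ (P ⊛ G′)) ⊝)) (⊛-zeroʳ ((one ⊖ z) ⊛ P)))
                         (⊕-identityʳ ((y ⊛ (P ⊛ G′)) ⊝))) ⟩
      (y ⊛ (P ⊛ G′)) ⊝ ∎
      where
      open SetoidReasoning ≐⁰-setoid
      P  = Fprod j N
      y  = yq^ j
      z  = mono (+ 1) 0 1 (K * (t + 0))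
      G′ = G (j + s) (suc t)
      τ  = term (j + s) (suc t) N
      z-multiple : z ⊛ (y ⊛ (P ⊛ G′)) ≐⁰ zero-PS
      z-multiple = coeffwise⁰ λ { a b c (_ , ≡.refl) →
        mono-⊛-coeff-∤ (+ 1) 0 1 (K * (t + 0)) (y ⊛ (P ⊛ G′)) a 0 c λ { (_ , () , _) } }

    H-nonneg : (∀ j t → H j t ≐⁰ H (suc j) t) → ∀ b j t a c → a + c ≤ N → + 0 ≤ℤ H j t a b c
    H-nonneg H-z⁰-j-invariant = <-rec Nonneg-at step
      where
      Nonneg-at : ℕ → Set
      Nonneg-at b = ∀ j t a c → a + c ≤ N → + 0 ≤ℤ H j t a b c

      H-z⁰-j-shift : ∀ d j t a c → a + c ≤ N → H j t a 0 c ≡ H (d + j) t a 0 c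
      H-z⁰-j-shift zero    j t a c a+c≤N = ≡.refl
      H-z⁰-j-shift (suc d) j t a c a+c≤N =
        ≡.trans (H-z⁰-j-shift d j t a c a+c≤N) (coeff⁰ (H-z⁰-j-invariant (d + j) t) a 0 c (a+c≤N , ≡.refl))

      -- moving to j′ = c + j makes the support bound (j′ + 1) a exceed c as soon as a ≥ 1
      z⁰ : Nonneg-at 0
      z⁰ j t zero    c a+c≤N = H-y⁰-nonneg j t 0 c
      z⁰ j t (suc a) c a+c≤N = ℤₚ.≤-reflexive (≡.sym (≡.trans (H-z⁰-j-shift c j t (suc a) c a+c≤N)
        (vanish (H-supported (c + j) t) (suc a) 0 c
          (ℕₚ.<-≤-trans (s≤s (ℕₚ.m≤m+n c j))
                        (ℕₚ.≤-trans (ℕₚ.m≤m*n (suc (c + j)) (suc a)) (ℕₚ.m≤m+n _ _))))))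

      -- for fixed z-degree b + 1 the recurrence in t has nonnegative increments; descend from
      -- t large, where the support bound K t (b + 1) > c forces the coefficient to vanish
      step : ∀ b → (∀ {b′} → b′ < b → Nonneg-at b′) → Nonneg-at b
      step zero    _  = z⁰
      step (suc b) IH j t a c a+c≤N = descend (suc c) t (ℕₚ.<-≤-trans (ℕₚ.n<1+n c) (ℕₚ.m≤n+m (suc c) t)) j a a+c≤N
        where
        z≤b : DownSet
        z≤b = record
          { Member = λ a′ b′ c′ → a′ + c′ ≤ N × b′ ≤ b
          ; closed = λ (a+c≤N , b′≤b) i≤a j≤b l≤c →
              ℕₚ.≤-trans (ℕₚ.+-mono-≤ i≤a l≤c) a+c≤N , ℕₚ.≤-trans j≤b b′≤b }
        open OnDownSet z≤b using () renaming (⊛-nonnegᴰ to ⊛-nonneg≤b)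

        descend : ∀ u t → c < t + u → ∀ j a → a + c ≤ N → + 0 ≤ℤ H j t a (suc b) c
        descend zero t c<t j a a+c≤N = ℤₚ.≤-reflexive (≡.sym (vanish (H-supported j t) a (suc b) c
          (ℕₚ.<-≤-trans (≡.subst (c <_) (ℕₚ.+-identityʳ t) c<t)
            (ℕₚ.≤-trans (ℕₚ.m≤n*m t K) (ℕₚ.≤-trans (ℕₚ.m≤m*n (K * t) (suc b)) (ℕₚ.m≤n+m _ _))))))
        descend (suc u) t c<t+1+u j a a+c≤N =
          ≡.subst (+ 0 ≤ℤ_) (≡.sym (coeffᴺ (H-t-recurrence j t) a (suc b) c a+c≤N))
            (ℤₚ.+-mono-≤ (descend u (suc t) (≡.subst (c <_) (ℕₚ.+-suc t u) c<t+1+u) j a a+c≤N)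
                         (≡.subst (+ 0 ≤ℤ_) (≡.sym (sum≤-coeff k _ a (suc b) c))
                            (sumTo-nonneg k λ r _ → summand-nonneg r)))
          where
          X : ℕ → PS
          X r = Fprod j (s + r) ⊛ H (j + s + r) (suc t)
          X-nonneg : ∀ r a′ b′ c′ → a′ + c′ ≤ N × b′ ≤ b → + 0 ≤ℤ X r a′ b′ c′
          X-nonneg r = ⊛-nonneg≤b
            (λ a′ b′ c′ _ → prod1-nonneg (λ i → F (j + i)) (s + r) (λ i → F-nonneg (j + suc i)) a′ b′ c′)
            (λ a′ b′ c′ (a′+c′≤N , b′≤b) → IH (s≤s b′≤b) (j + s + r) (suc t) a′ c′ a′+c′≤N)
          summand-nonneg : ∀ r → + 0 ≤ℤ (yzq^ t j r ⊛ X r) a (suc b) c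
          summand-nonneg r with divides³? 1 1 (K * t + suc (j + r)) a (suc b) c
          ... | yes d@(_ , _ , γ≤c) =
            ≡.subst (+ 0 ≤ℤ_) (≡.sym (≡.trans (mono-⊛-coeff (+ 1) 1 1 _ (X r) a (suc b) c d) (ℤₚ.*-identityˡ _)))
              (X-nonneg r (a ∸ 1) b (c ∸ (K * t + suc (j + r)))
                 (ℕₚ.≤-trans (ℕₚ.+-mono-≤ (ℕₚ.m∸n≤m a 1) (ℕₚ.m∸n≤m c (K * t + suc (j + r)))) a+c≤N
                 , ℕₚ.≤-refl))
          ... | no ∤ = ℤₚ.≤-reflexive (≡.sym (mono-⊛-coeff-∤ (+ 1) 1 1 _ (X r) a (suc b) c ∤))

≤⇒y-weight≤ : ∀ u v {i} → u ≤ i → u * 1 + v * 0 ≤ i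
≤⇒y-weight≤ u v = ≡.subst (_≤ _) (≡.sym (weight u v))
  where
  weight : ∀ u v → u * 1 + v * 0 ≡ u
  weight = solve-∀

n≤tri : ∀ n → n ≤ tri n
n≤tri zero    = z≤n
n≤tri (suc n) = ℕₚ.m≤n+m (suc n) (tri n)

module SeriesA (k N : ℕ) where

  ex : ℕ → ℕ → ℕ
  ex j n = tri n + j * n

  ex-suc : ∀ j n → ex j (suc n) ≡ ex (j + 1) n + suc j
  ex-suc j n = rearrange (tri n) j n
    where
    rearrange : ∀ T j n → T + suc n + j * suc n ≡ T + (j + 1) * n + suc j
    rearrange = solve-∀

  ex-shift : ∀ j n r → ex j n + r * n ≡ ex (j + r) n
  ex-shift j n r = rearrange (tri n) j n r
    where
    rearrange : ∀ T j n r → T + j * n + r * n ≡ T + (j + r) * n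
    rearrange = solve-∀

  ex-lower : ∀ j n → suc j * n ≤ ex j n
  ex-lower j n = ℕₚ.+-monoˡ-≤ (j * n) (n≤tri n)

  open Positivity k N 1 ex ex-suc ex-shift ex-lower (geom 1 0)

  F-trivial : ∀ i → N < i → geom 1 0 i ≐ᴺ one
  F-trivial (suc i) N<1+i = OnDownSet.coeffwiseᴰ λ a b c a+c≤N →
    geom-below 1 0 i a b c (ℕₚ.≤-<-trans (ℕₚ.≤-trans (ℕₚ.m≤n+m c a) a+c≤N) N<1+i)

  F-supported : ∀ u v i → u ≤ i → Supported u v (geom 1 0 i)
  F-supported u v i u≤i = geom-supported 1 0 i (≤⇒y-weight≤ u v u≤i)

  open WithFactorBounds (geom-nonneg 1 0) F-trivial F-supported

  H-z⁰-j-invariant : ∀ j t → H j t ≐⁰ H (suc j) t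
  H-z⁰-j-invariant j t = begin
    H j t
      ≈⟨ ≐⇒≐⁰ (solve-PS 2 (λ h g → h := (h :- g) :+ g) ≐-refl (H j t) (P ⊛ G (suc j) t)) ⟩
    (H j t ⊖ (P ⊛ G (suc j) t)) ⊕ (P ⊛ G (suc j) t)
      ≈⟨ ⊕-cong⁰ (H-j-difference j t) (≐ᴺ⇒≐⁰ (Fprod-peel j (G (suc j) t))) ⟩
    ((y ⊛ (P ⊛ G (j + 1) (suc t))) ⊝) ⊕ (W ⊛ H (suc j) t)
      ≈⟨ ⊕-cong⁰ (⊝-cong⁰ (⊛-cong⁰ (≐⁰-refl {y}) (≐ᴺ⇒≐⁰ (Fprod-peel j (G (j + 1) (suc t))))))
                 (≐⁰-refl {W ⊛ H (suc j) t}) ⟩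
    ((y ⊛ (W ⊛ (Fprod (suc j) N ⊛ G (j + 1) (suc t)))) ⊝) ⊕ (W ⊛ H (suc j) t)
      ≈⟨ ⊕-cong⁰ (⊝-cong⁰ (⊛-cong⁰ (≐⁰-refl {y}) (⊛-cong⁰ (≐⁰-refl {W})
                   (≐⁰-trans (≐⇒≐⁰ (⊛-congˡ (Fprod (suc j) N)
                                      (≡⇒≐ (≡.cong (λ i → G i (suc t)) (ℕₚ.+-comm j 1)))))
                             (H-z⁰-t-invariant (suc j) t)))))
                 (≐⁰-refl {W ⊛ H (suc j) t}) ⟩
    ((y ⊛ (W ⊛ H (suc j) t)) ⊝) ⊕ (W ⊛ H (suc j) t)
      ≈⟨ ≐⇒≐⁰ (solve-PS 3 (λ y w h → (:- (y :* (w :* h))) :+ (w :* h) := ((con (+ 1) :- y) :* w) :* h)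
                        ≐-refl y W (H (suc j) t)) ⟩
    ((one ⊖ y) ⊛ W) ⊛ H (suc j) t
      ≈⟨ ≐⇒≐⁰ (≐-trans (⊛-congʳ (H (suc j) t) (geom-inverse 1 0 j)) (⊛-identityˡ (H (suc j) t))) ⟩
    H (suc j) t ∎
    where
    open SetoidReasoning ≐⁰-setoid
    P = Fprod j N
    y = yq^ j
    W = geom 1 0 (suc j)

  seriesA-nonneg : ∀ a b c → a + c ≤ N → + 0 ≤ℤ seriesA (suc k) N a b c
  seriesA-nonneg a b c a+c≤N =
    ≡.subst (+ 0 ≤ℤ_) (coeff H≐seriesA a b c) (H-nonneg H-z⁰-j-invariant b 0 0 a c a+c≤N)
    where
    H≐seriesA : H 0 0 ≐ seriesA (suc k) N
    H≐seriesA = ⊛-congˡ (invYQ N) (sumPS-cong N λ n →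
      ⊛-congʳ (zPoch (suc k) n ⊛ qPochInv n) (mono-cong ≡.refl ≡.refl ≡.refl (ℕₚ.+-identityʳ (tri n))))

module SeriesB (k N : ℕ) where

  ex : ℕ → ℕ → ℕ
  ex j n = n + j * n

  ex-suc : ∀ j n → ex j (suc n) ≡ ex (j + 0) n + suc j
  ex-suc j n = rearrange j n
    where
    rearrange : ∀ j n → suc n + j * suc n ≡ n + (j + 0) * n + suc j
    rearrange = solve-∀

  ex-shift : ∀ j n r → ex j n + r * n ≡ ex (j + r) n
  ex-shift j n r = rearrange j n r
    where
    rearrange : ∀ j n r → n + j * n + r * n ≡ n + (j + r) * n
    rearrange = solve-∀

  ex-lower : ∀ j n → suc j * n ≤ ex j n
  ex-lower j n = ℕₚ.≤-refl

  F : ℕ → PS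
  F i = one ⊕ mono (+ 1) 1 0 i

  open Positivity k N 0 ex ex-suc ex-shift ex-lower F

  F-nonneg : ∀ i → Nonneg (F i)
  F-nonneg i = ⊕-nonneg (mono-nonneg 1 0 0 0) (mono-nonneg 1 1 0 i)

  F-trivial : ∀ i → N < i → F i ≐ᴺ one
  F-trivial i N<i = OnDownSet.coeffwiseᴰ λ a b c a+c≤N →
    ≡.trans (≡.cong (one a b c +ℤ_) (mono-off (+ 1) 1 0 i a b c λ { (_ , _ , ≡.refl) →
              ℕₚ.<-irrefl ≡.refl (ℕₚ.≤-<-trans (ℕₚ.≤-trans (ℕₚ.m≤n+m i a) a+c≤N) N<i) }))
            (ℤₚ.+-identityʳ _)

  F-supported : ∀ u v i → u ≤ i → Supported u v (F i)
  F-supported u v i u≤i = ⊕-supported one-supported (mono-supported (+ 1) 1 0 i (≤⇒y-weight≤ u v u≤i))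

  open WithFactorBounds F-nonneg F-trivial F-supported

  -- here the j-difference only gives (1 + y q^(j+1)) H j t ≐ (1 + y q^(j+1)) H (j+1) t in z-degree 0
  H-z⁰-j-invariant : ∀ j t → H j t ≐⁰ H (suc j) t
  H-z⁰-j-invariant j t = one⊕yq^-cancel (suc j) (begin
    (one ⊕ y) ⊛ H j t
      ≈⟨ ≐⇒≐⁰ (solve-PS 3 (λ y h g → (con (+ 1) :+ y) :* h := ((h :- g) :+ g) :+ y :* h)
                        ≐-refl y (H j t) (P ⊛ G (suc j) t)) ⟩
    ((H j t ⊖ (P ⊛ G (suc j) t)) ⊕ (P ⊛ G (suc j) t)) ⊕ (y ⊛ H j t)
      ≈⟨ ⊕-cong⁰ (⊕-cong⁰ (H-j-difference j t) (≐ᴺ⇒≐⁰ (Fprod-peel j (G (suc j) t))))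
                 (≐⁰-refl {y ⊛ H j t}) ⟩
    (((y ⊛ (P ⊛ G (j + 0) (suc t))) ⊝) ⊕ (F (suc j) ⊛ H (suc j) t)) ⊕ (y ⊛ H j t)
      ≈⟨ ⊕-cong⁰ (⊕-cong⁰ (⊝-cong⁰ (⊛-cong⁰ (≐⁰-refl {y})
                   (≐⁰-trans (≐⇒≐⁰ (⊛-congˡ P (≡⇒≐ (≡.cong (λ i → G i (suc t)) (ℕₚ.+-identityʳ j)))))
                             (H-z⁰-t-invariant j t))))
                 (≐⁰-refl {F (suc j) ⊛ H (suc j) t})) (≐⁰-refl {y ⊛ H j t}) ⟩
    (((y ⊛ H j t) ⊝) ⊕ (F (suc j) ⊛ H (suc j) t)) ⊕ (y ⊛ H j t)
      ≈⟨ ≐⇒≐⁰ (solve-PS 2 (λ x w → ((:- x) :+ w) :+ x := w) ≐-refl (y ⊛ H j t) (F (suc j) ⊛ H (suc j) t)) ⟩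
    (one ⊕ y) ⊛ H (suc j) t ∎)
    where
    open SetoidReasoning ≐⁰-setoid
    P = Fprod j N
    y = yq^ j

  seriesB-nonneg : ∀ a b c → a + c ≤ N → + 0 ≤ℤ seriesB (suc k) N a b c
  seriesB-nonneg a b c a+c≤N =
    ≡.subst (+ 0 ≤ℤ_) (coeff H≐seriesB a b c) (H-nonneg H-z⁰-j-invariant b 0 0 a c a+c≤N)
    where
    H≐seriesB : H 0 0 ≐ seriesB (suc k) N
    H≐seriesB = ⊛-congˡ (negYQ N) (sumPS-cong N λ n →
      ⊛-congʳ (zPoch (suc k) n ⊛ qPochInv n) (mono-cong ≡.refl ≡.refl ≡.refl (ℕₚ.+-identityʳ n)))

corollary1p8 : (k : ℕ) → k ≥ 1 → (ℓ m n : ℕ) →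
    (+ 0 ≤ℤ coeffA k ℓ m n) × (+ 0 ≤ℤ coeffB k ℓ m n)
corollary1p8 (suc k) _ ℓ m n =
  SeriesA.seriesA-nonneg k (ℓ + n) ℓ m n ℕₚ.≤-refl , SeriesB.seriesB-nonneg k (ℓ + n) ℓ m n ℕₚ.≤-refl
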